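{- Let $G=(A\cup P,\mathcal{E})$ be an instance of the rank-maximal matching problem and let $a,a'\in A$ be two applicants with identical preference lists (same neighbours with the same ranks). If the edge $(a,p)$ belongs to some rank-maximal matching of $G$, then the edge $(a',p)$ is present in the reduced graph of $G$.
   Context: Edges $(a,p)$ carry positive integer ranks in $\{1,\dots,r\}$ (smaller = more preferred by $a$). A matching is a set of edges no two sharing an endpoint; its signature is $(x_1,\dots,x_r)$ with $x_i$ the number of applicants matched by rank $i$ edges, and a matching is rank-maximal if its signature is lexicographically largest. $G_i$ is the subgraph of edges of rank at most $i$. For a bipartite graph $K$ with maximum matching $M$, a vertex is even (resp. odd) if reachable from an $M$-unmatched vertex by an $M$-alternating path of even (resp. odd) length, and unreachable otherwise; the sets $E(K),O(K),U(K)$ do not depend on $M$. Reduced graphs: $G'_1=G_1$; for $i=1,\dots,r$: compute $E(G'_i),O(G'_i),U(G'_i)$, delete all edges of rank $>i$ incident to vertices of $O(G'_i)\cup U(G'_i)$, delete from $G'_i$ all edges between $O(G'_i)$ and $O(G'_i)\cup U(G'_i)$, and let $G'_{i+1}$ be the result plus the remaining edges of rank $i+1$. The reduced graph of $G$ is the graph obtained at the end of phase $r$; it contains every rank-maximal matching of $G$. -}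

module Defs where

open import Data.Nat using (ℕ; zero; suc; _≤_; _<_)
open import Data.Nat.Properties using ()
open import Data.Fin using (Fin; toℕ; _≟_)
open import Data.Bool using (Bool; true; false; not; _∧_)
open import Data.Maybe using (Maybe; just; nothing)
open import Data.List using (List; []; _∷_; length; map; filterᵇ; allFin)
open import Data.Bool.ListAction using (any)
open import Data.List.Relation.Unary.Unique.Propositional using (Unique)
open import Data.Sum using (_⊎_; inj₁; inj₂)
open import Data.Product using (Σ; _×_; ∃; _,_)
open import Data.Unit using (⊤)
open import Data.Empty using (⊥)
open import Relation.Nullary using (¬_; does)
open import Relation.Binary.PropositionalEquality using (_≡_; _≢_)

-- Applicants are Fin nA, posts are Fin nP.  rank a p = nothing means
-- (a,p) is not an edge; rank a p = just j (j : Fin r) means (a,p) is an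
-- edge of rank  toℕ j + 1  ∈ {1,…,r}.

record Instance : Set where
  field
    nA nP r : ℕ
    rank    : Fin nA → Fin nP → Maybe (Fin r)

rankℕ : {r : ℕ} → Fin r → ℕ
rankℕ j = suc (toℕ j)

module _ (I : Instance) where
  open Instance I

  A = Fin nA
  P = Fin nP

  V : Set
  V = A ⊎ P

  -- a (spanning) subgraph of G on the same vertex set A ∪ P,
  -- given by its edge set
  Graph : Set₁
  Graph = A → P → Set

  IsEdge : Graph
  IsEdge a p = rank a p ≢ nothing

  RankLe : ℕ → A → P → Set
  RankLe k a p = Σ (Fin r) λ j → (rank a p ≡ just j) × (rankℕ j ≤ k)

  RankGt : ℕ → A → P → Set
  RankGt k a p = Σ (Fin r) λ j → (rank a p ≡ just j) × (k < rankℕ j)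

  Sel : Set
  Sel = A → P → Bool

  IsMatching : Graph → Sel → Set
  IsMatching K M =
    (∀ a p → M a p ≡ true → K a p) ×
    (∀ a p p' → M a p ≡ true → M a p' ≡ true → p ≡ p') ×
    (∀ a a' p → M a p ≡ true → M a' p ≡ true → a ≡ a')

  -- number of edges of M (= number of matched applicants, M a matching)
  size : Sel → ℕ
  size M = length (filterᵇ (λ a → any (M a) (allFin nP)) (allFin nA))

  IsMaximumMatching : Graph → Sel → Set
  IsMaximumMatching K M = IsMatching K M × (∀ M' → IsMatching K M' → size M' ≤ size M)

  hasRank : Maybe (Fin r) → Fin r → Bool
  hasRank nothing  j = false
  hasRank (just k) j = does (k ≟ j)

  -- x_i : number of applicants matched by a rank-(toℕ j + 1) edge
  countRank : Sel → Fin r → ℕ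
  countRank M j =
    length (filterᵇ (λ a → any (λ p → M a p ∧ hasRank (rank a p) j) (allFin nP)) (allFin nA))

  signature : Sel → List ℕ
  signature M = map (countRank M) (allFin r)

  LexLe : List ℕ → List ℕ → Set
  LexLe []       []       = ⊤
  LexLe (x ∷ xs) (y ∷ ys) = (x < y) ⊎ ((x ≡ y) × LexLe xs ys)
  LexLe _        _        = ⊥

  IsRankMaximal : Sel → Set
  IsRankMaximal M =
    IsMatching IsEdge M × (∀ M' → IsMatching IsEdge M' → LexLe (signature M') (signature M))

  Adj : Graph → V → V → Set
  Adj K (inj₁ a) (inj₂ p) = K a p
  Adj K (inj₂ p) (inj₁ a) = K a p
  Adj K _        _        = ⊥

  InM : Sel → V → V → Bool
  InM M (inj₁ a) (inj₂ p) = M a p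
  InM M (inj₂ p) (inj₁ a) = M a p
  InM M _        _        = false

  Unmatched : Sel → V → Set
  Unmatched M (inj₁ a) = ∀ p → M a p ≡ false
  Unmatched M (inj₂ p) = ∀ a → M a p ≡ false

  -- consecutive vertices adjacent in K; edges alternately outside / inside M,
  -- the Bool saying whether the next edge must be in M
  AltSteps : Graph → Sel → Bool → V → List V → Set
  AltSteps K M b x []       = ⊤
  AltSteps K M b x (y ∷ ys) = Adj K x y × (InM M x y ≡ b) × AltSteps K M (not b) y ys

  lastOf : V → List V → V
  lastOf x []       = x
  lastOf x (y ∷ ys) = lastOf y ys

  -- an M-alternating path  v₀ v₁ … v_k  (k = length vs) in K starting at
  -- an M-unmatched vertex v₀ and ending at v
  AltPath : Graph → Sel → V → List V → V → Set
  AltPath K M v₀ vs v =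
    Unmatched M v₀ × Unique (v₀ ∷ vs) × AltSteps K M false v₀ vs × (lastOf v₀ vs ≡ v)

  data Parity : ℕ → Bool → Set where
    p-zero : Parity zero true
    p-suc  : ∀ {n b} → Parity n b → Parity (suc n) (not b)

  EvenWrt : Graph → Sel → V → Set
  EvenWrt K M v = ∃ λ v₀ → ∃ λ vs → AltPath K M v₀ vs v × Parity (length vs) true

  OddWrt : Graph → Sel → V → Set
  OddWrt K M v = ∃ λ v₀ → ∃ λ vs → AltPath K M v₀ vs v × Parity (length vs) false

  -- E(K), O(K), U(K), computed with a maximum matching of K
  -- (these sets do not depend on the choice of maximum matching)
  Even : Graph → V → Set
  Even K v = ∃ λ M → IsMaximumMatching K M × EvenWrt K M v

  Odd : Graph → V → Set
  Odd K v = ∃ λ M → IsMaximumMatching K M × OddWrt K M v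

  Unreach : Graph → V → Set
  Unreach K v = ¬ Even K v × ¬ Odd K v

  OddOrUnreach : Graph → V → Set
  OddOrUnreach K v = Odd K v ⊎ Unreach K v

  -- G'_k computed from the edges R remaining before phase k:
  -- the remaining edges of rank ≤ k
  Phase : ℕ → Graph → Graph
  Phase k R a p = R a p × RankLe k a p

  prune : ℕ → Graph → Graph
  prune k R a p =
    R a p ×
    ¬ (RankGt k a p ×
       (OddOrUnreach K (inj₁ a) ⊎ OddOrUnreach K (inj₂ p))) ×
    ¬ (K a p ×
       ((Odd K (inj₁ a) × OddOrUnreach K (inj₂ p)) ⊎
        (Odd K (inj₂ p) × OddOrUnreach K (inj₁ a))))
    where
      K : Graph
      K = Phase k R

  -- edges of G still present after phases 1,…,i (all ranks);
  -- Remaining 0 = G, and G'_{i+1} = Phase (suc i) (Remaining i).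
  Remaining : ℕ → Graph
  Remaining zero    = IsEdge
  Remaining (suc i) = prune (suc i) (Remaining i)

  Reduced : Graph
  Reduced = Remaining r

module Submission where

-- Swapping a and a' is a rank-preserving permutation of the applicants,
-- so renaming M along it gives a rank-maximal matching containing (a',p)
-- (module Symmetry).  Hence it suffices that every rank-maximal matching lies
-- in the reduced graph (module Reduced).  That is proved by induction on the
-- phases: the edges of M of rank ≤ i form a maximum matching of G'_i, and no
-- edge of M is deleted.

open import Defs
open import Data.Bool using (true)
open import Data.Product using (Σ; _×_)
open import Data.Product using (_,_)
open import Relation.Binary.PropositionalEquality using (_≡_; _≢_)
open import Relation.Binary.PropositionalEquality using (trans; cong)

module Counting where

  open import Data.Nat using (ℕ; zero; suc; _+_; _≤_; _<_; z≤n; s≤s)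
  open import Data.Nat.Properties
  open import Data.Fin using (Fin; zero; suc; punchIn)
  open import Data.Fin.Properties using (punchInᵢ≢i)
  open import Data.Fin.Permutation using (Permutation; _⟨$⟩ʳ_)
  open import Data.Bool using (Bool; true; false; _∨_)
  open import Data.List using ([]; _∷_; length; filterᵇ; tabulate)
  open import Data.Bool.ListAction using (any)
  open import Data.Bool.Properties using (∨-zeroʳ)
  open import Data.Product using (Σ; _×_; _,_)
  open import Data.Empty using (⊥; ⊥-elim)
  open import Function using (_∘_)
  open import Relation.Binary.PropositionalEquality
  open import Algebra.Properties.CommutativeMonoid.Sum +-0-commutativeMonoid
    using (sum; sum-cong-≗; sum-remove; ∑-distrib-+; sum-permute)

  indicator : Bool → ℕ
  indicator true  = 1
  indicator false = 0

  count : ∀ {n} → (Fin n → Bool) → ℕ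
  count f = sum (indicator ∘ f)

  length-filter-tabulate : ∀ {A : Set} n (f : A → Bool) (g : Fin n → A) →
    length (filterᵇ f (tabulate g)) ≡ count (f ∘ g)
  length-filter-tabulate zero    f g = refl
  length-filter-tabulate (suc n) f g with f (g zero)
  ... | true  = cong suc (length-filter-tabulate n f (g ∘ suc))
  ... | false = length-filter-tabulate n f (g ∘ suc)

  count-cong : ∀ {n} {f g : Fin n → Bool} → (∀ i → f i ≡ g i) → count f ≡ count g
  count-cong e = sum-cong-≗ (cong indicator ∘ e)

  indicator-mono : ∀ {x y} → (x ≡ true → y ≡ true) → indicator x ≤ indicator y
  indicator-mono {false} h = z≤n
  indicator-mono {true}  h rewrite h refl = ≤-refl

  count-mono : ∀ {n} {f g : Fin n → Bool} → (∀ i → f i ≡ true → g i ≡ true) → count f ≤ count g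
  count-mono {zero}  h = z≤n
  count-mono {suc n} h = +-mono-≤ (indicator-mono (h zero)) (count-mono (h ∘ suc))

  count-false : ∀ {n} {f : Fin n → Bool} → (∀ i → f i ≡ false) → count f ≡ 0
  count-false {zero}  h = refl
  count-false {suc n} h rewrite h zero = count-false (h ∘ suc)

  count-point : ∀ {n} {f g : Fin n → Bool} (i : Fin n) → f i ≡ false → g i ≡ true →
    (∀ k → k ≢ i → f k ≡ g k) → count g ≡ suc (count f)
  count-point {suc n} {f} {g} i fi gi agree = begin
    count g                                       ≡⟨ sum-remove {i = i} (indicator ∘ g) ⟩
    indicator (g i) + count (g ∘ punchIn i)       ≡⟨ cong₂ (λ x y → indicator x + y) gi (sym rest) ⟩
    1 + count (f ∘ punchIn i)                     ≡⟨ cong (λ x → suc (indicator x + count (f ∘ punchIn i))) fi ⟨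
    suc (indicator (f i) + count (f ∘ punchIn i)) ≡⟨ cong suc (sum-remove {i = i} (indicator ∘ f)) ⟨
    suc (count f)                                 ∎
    where
    open ≡-Reasoning
    rest : count (f ∘ punchIn i) ≡ count (g ∘ punchIn i)
    rest = count-cong (λ k → agree (punchIn i k) (punchInᵢ≢i i k))

  witness-suc : ∀ {n} {f g : Fin (suc n) → Bool} → Σ (Fin n) (λ i → g (suc i) ≡ true × f (suc i) ≡ false) →
    Σ (Fin (suc n)) λ i → g i ≡ true × f i ≡ false
  witness-suc (i , gi , fi) = suc i , gi , fi

  count-witness : ∀ {n} {f g : Fin n → Bool} → count f < count g → Σ (Fin n) λ i → g i ≡ true × f i ≡ false
  count-witness {zero} ()
  count-witness {suc n} {f} {g} lt with f zero in ef | g zero in eg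
  ... | false | true  = zero , eg , ef
  ... | true  | true  = witness-suc (count-witness (≤-pred lt))
  ... | false | false = witness-suc (count-witness lt)
  ... | true  | false = witness-suc (count-witness (≤-trans (n≤1+n _) lt))

  count-∨ : ∀ {n} {f g : Fin n → Bool} → (∀ i → f i ≡ true → g i ≡ true → ⊥) →
    count (λ i → f i ∨ g i) ≡ count f + count g
  count-∨ {f = f} {g} disjoint =
    trans (sum-cong-≗ (λ i → indicator-∨ (f i) (g i) (disjoint i))) (∑-distrib-+ (indicator ∘ f) (indicator ∘ g))
    where
    indicator-∨ : ∀ x y → (x ≡ true → y ≡ true → ⊥) → indicator (x ∨ y) ≡ indicator x + indicator y
    indicator-∨ true  true  h = ⊥-elim (h refl refl)
    indicator-∨ true  false h = refl
    indicator-∨ false y     h = refl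

  count-strict : ∀ {n} {f g : Fin n → Bool} (i : Fin n) → (∀ k → f k ≡ true → g k ≡ true) →
    f i ≡ false → g i ≡ true → count f < count g
  count-strict {suc n} zero    f⇒g fi gi rewrite fi | gi = s≤s (count-mono (f⇒g ∘ suc))
  count-strict {suc n} {f} (suc i) f⇒g fi gi =
    +-mono-≤-< (indicator-mono (f⇒g zero)) (count-strict i (f⇒g ∘ suc) fi gi)

  count-permute : ∀ {n} (f : Fin n → Bool) (π : Permutation n n) → count (f ∘ (π ⟨$⟩ʳ_)) ≡ count f
  count-permute f π = sym (sum-permute (indicator ∘ f) π)

  any-tabulate⁻ : ∀ {B : Set} n (f : B → Bool) (g : Fin n → B) → any f (tabulate g) ≡ true →
    Σ (Fin n) λ i → f (g i) ≡ true
  any-tabulate⁻ zero    f g ()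
  any-tabulate⁻ (suc n) f g e with f (g zero) in e0
  ... | true  = zero , e0
  ... | false with any-tabulate⁻ n f (g ∘ suc) e
  ...   | i , h = suc i , h

  any-tabulate⁺ : ∀ {B : Set} n (f : B → Bool) (g : Fin n → B) (i : Fin n) → f (g i) ≡ true →
    any f (tabulate g) ≡ true
  any-tabulate⁺ (suc n) f g zero    e rewrite e = refl
  any-tabulate⁺ (suc n) f g (suc i) e with f (g zero)
  ... | true  = refl
  ... | false = any-tabulate⁺ n f (g ∘ suc) i e

  any-cong : ∀ {B : Set} {u v : B → Bool} xs → (∀ x → u x ≡ v x) → any u xs ≡ any v xs
  any-cong []       h = refl
  any-cong (x ∷ xs) h = cong₂ _∨_ (h x) (any-cong xs h)

  any-∨ : ∀ {B : Set} (u v : B → Bool) xs → any (λ x → u x ∨ v x) xs ≡ any u xs ∨ any v xs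
  any-∨ u v []       = refl
  any-∨ u v (x ∷ xs) with u x | v x
  ... | true  | _     = refl
  ... | false | true  = sym (∨-zeroʳ _)
  ... | false | false = any-∨ u v xs

-- Matchings viewed from the vertices: a selection M joins two vertices s, t
-- when {s,t} is one of its edges.
module Matchings (I : Instance) where

  open import Data.Nat using (suc; _≤_; _<_)
  import Data.Fin
  import Data.Fin.Properties as FP
  open import Data.Bool using (Bool; true; false; _∨_; _∧_; not)
  open import Data.Bool.Properties using (¬-not; ∨-zeroʳ)
  open import Data.List using (allFin)
  open import Data.Bool.ListAction using (any)
  open import Data.Product using (Σ; _×_; _,_; proj₁)
  open import Data.Sum using (_⊎_; inj₁; inj₂)
  open import Data.Sum.Properties using (≡-dec; inj₁-injective; inj₂-injective)
  open import Data.Empty using (⊥; ⊥-elim)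
  open import Data.Unit using (⊤; tt)
  open import Relation.Binary.PropositionalEquality
  open import Function using (_∘_; _∋_)
  open import Relation.Nullary using (¬_; yes; no; Dec; does)
  open import Relation.Nullary.Decidable using (dec-true)
  open import Relation.Binary using (DecidableEquality)
  open Counting

  open Instance I

  Vertex : Set
  Vertex = V I

  Joins : Sel I → Vertex → Vertex → Bool
  Joins = InM I

  _≟V_ : DecidableEquality Vertex
  _≟V_ = ≡-dec Data.Fin._≟_ Data.Fin._≟_

  Across : Vertex → Vertex → Set
  Across (inj₁ _) (inj₂ _) = ⊤
  Across (inj₂ _) (inj₁ _) = ⊤
  Across _        _        = ⊥

  Across-sym : ∀ {s t} → Across s t → Across t s
  Across-sym {inj₁ _} {inj₂ _} o = tt
  Across-sym {inj₂ _} {inj₁ _} o = tt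

  Across-irrefl : ∀ {s} → Across s s → ⊥
  Across-irrefl {inj₁ _} ()
  Across-irrefl {inj₂ _} ()

  Across⇒≢ : ∀ {s t} → Across s t → s ≢ t
  Across⇒≢ o refl = Across-irrefl o

  Joins-sym : ∀ M s t → Joins M s t ≡ Joins M t s
  Joins-sym M (inj₁ a) (inj₁ b) = refl
  Joins-sym M (inj₁ a) (inj₂ p) = refl
  Joins-sym M (inj₂ p) (inj₁ a) = refl
  Joins-sym M (inj₂ p) (inj₂ q) = refl

  Joins⇒Across : ∀ M s t → Joins M s t ≡ true → Across s t
  Joins⇒Across M (inj₁ a) (inj₂ p) e = tt
  Joins⇒Across M (inj₂ p) (inj₁ a) e = tt

  Adj⇒Across : ∀ K s t → Adj I K s t → Across s t
  Adj⇒Across K (inj₁ a) (inj₂ p) e = tt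
  Adj⇒Across K (inj₂ p) (inj₁ a) e = tt

  Adj-sym : ∀ K s t → Adj I K s t → Adj I K t s
  Adj-sym K (inj₁ a) (inj₂ p) e = e
  Adj-sym K (inj₂ p) (inj₁ a) e = e

  IsSymMatching : Graph I → Sel I → Set
  IsSymMatching K M =
    (∀ s t → Joins M s t ≡ true → Adj I K s t) ×
    (∀ s t t' → Joins M s t ≡ true → Joins M s t' ≡ true → t ≡ t')

  toSym : ∀ {K M} → IsMatching I K M → IsSymMatching K M
  toSym {K} {M} (inK , funA , funP) = edges , functional
    where
    edges : ∀ s t → Joins M s t ≡ true → Adj I K s t
    edges (inj₁ a) (inj₂ p) e = inK a p e
    edges (inj₂ p) (inj₁ a) e = inK a p e
    functional : ∀ s t t' → Joins M s t ≡ true → Joins M s t' ≡ true → t ≡ t'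
    functional (inj₁ a) (inj₂ p) (inj₂ p') e e' = cong inj₂ (funA a p p' e e')
    functional (inj₂ p) (inj₁ a) (inj₁ a') e e' = cong inj₁ (funP a a' p e e')
    functional (inj₁ a) (inj₂ p) (inj₁ b) e ()
    functional (inj₂ p) (inj₁ a) (inj₂ q) e ()

  fromSym : ∀ {K M} → IsSymMatching K M → IsMatching I K M
  fromSym (edges , functional) =
    (λ a p e → edges (inj₁ a) (inj₂ p) e) ,
    (λ a p p' e e' → inj₂-injective (functional (inj₁ a) (inj₂ p) (inj₂ p') e e')) ,
    (λ a a' p e e' → inj₁-injective (functional (inj₂ p) (inj₁ a) (inj₁ a') e e'))

  Matched : Sel I → Vertex → Set
  Matched M s = Σ Vertex λ t → Joins M s t ≡ true

  true≢false : ∀ {b} → b ≡ true → b ≡ false → ⊥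
  true≢false refl ()

  ≢true⇒false : ∀ {b} → ¬ (b ≡ true) → b ≡ false
  ≢true⇒false = ¬-not

  unmatched⇒¬Matched : ∀ {M s} → Unmatched I M s → ¬ Matched M s
  unmatched⇒¬Matched {M} {inj₁ a} u (inj₂ p , e) = true≢false e (u p)
  unmatched⇒¬Matched {M} {inj₂ p} u (inj₁ a , e) = true≢false e (u a)

  ¬Matched⇒unmatched : ∀ {M s} → ¬ Matched M s → Unmatched I M s
  ¬Matched⇒unmatched {M} {inj₁ a} n p = ≢true⇒false (λ e → n (inj₂ p , e))
  ¬Matched⇒unmatched {M} {inj₂ p} n a = ≢true⇒false (λ e → n (inj₁ a , e))

  Matched? : ∀ M s → Dec (Matched M s)
  Matched? M (inj₁ a) with FP.any? (λ p → M a p Data.Bool.≟ true)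
  ... | yes (p , e) = yes (inj₂ p , e)
  ... | no n = no λ { (inj₂ p , e) → n (p , e) }
  Matched? M (inj₂ p) with FP.any? (λ a → M a p Data.Bool.≟ true)
  ... | yes (a , e) = yes (inj₁ a , e)
  ... | no n = no λ { (inj₁ a , e) → n (a , e) }

  Matched-sym : ∀ M s t → Joins M s t ≡ true → Matched M t
  Matched-sym M s t e = s , trans (Joins-sym M t s) e

  matchedᵇ : Sel I → A I → Bool
  matchedᵇ M a = any (M a) (allFin nP)

  matchedᵇ⇒Matched : ∀ M a → matchedᵇ M a ≡ true → Matched M (inj₁ a)
  matchedᵇ⇒Matched M a e with any-tabulate⁻ nP (M a) (λ x → x) e
  ... | p , h = inj₂ p , h

  Matched⇒matchedᵇ : ∀ M a → Matched M (inj₁ a) → matchedᵇ M a ≡ true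
  Matched⇒matchedᵇ M a (inj₂ p , h) = any-tabulate⁺ nP (M a) (λ x → x) p h

  size≡count : ∀ M → size I M ≡ count (matchedᵇ M)
  size≡count M = length-filter-tabulate nA (matchedᵇ M) (λ x → x)

  CoversApplicants : Sel I → Sel I → Set
  CoversApplicants M M' = ∀ a → Matched M (inj₁ a) → Matched M' (inj₁ a)

  matchedᵇ-mono : ∀ {M M'} a → (Matched M (inj₁ a) → Matched M' (inj₁ a)) →
    matchedᵇ M a ≡ true → matchedᵇ M' a ≡ true
  matchedᵇ-mono {M} {M'} a h e = Matched⇒matchedᵇ M' a (h (matchedᵇ⇒Matched M a e))

  unmatchedᵇ : ∀ M a → ¬ Matched M (inj₁ a) → matchedᵇ M a ≡ false
  unmatchedᵇ M a n = ≢true⇒false (λ e → n (matchedᵇ⇒Matched M a e))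

  size-mono : ∀ {M M'} → CoversApplicants M M' → size I M ≤ size I M'
  size-mono {M} {M'} h rewrite size≡count M | size≡count M' = count-mono (λ a → matchedᵇ-mono a (h a))

  size-point : ∀ {M M'} (a₀ : A I) → ¬ Matched M (inj₁ a₀) → Matched M' (inj₁ a₀) →
    (∀ a → a ≢ a₀ → Matched M (inj₁ a) → Matched M' (inj₁ a)) →
    (∀ a → a ≢ a₀ → Matched M' (inj₁ a) → Matched M (inj₁ a)) →
    size I M' ≡ suc (size I M)
  size-point {M} {M'} a₀ n₀ m₀ h h' rewrite size≡count M | size≡count M' =
    count-point a₀ (unmatchedᵇ M a₀ n₀) (Matched⇒matchedᵇ M' a₀ m₀)
      λ a a≢a₀ → bool-ext (matchedᵇ-mono a (h a a≢a₀)) (matchedᵇ-mono a (h' a a≢a₀))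
    where
    bool-ext : ∀ {x y} → (x ≡ true → y ≡ true) → (y ≡ true → x ≡ true) → x ≡ y
    bool-ext {true}  f g = sym (f refl)
    bool-ext {false} {true}  f g = g refl
    bool-ext {false} {false} f g = refl

  size-witness : ∀ {M M'} → size I M < size I M' → Σ (A I) λ a → Matched M' (inj₁ a) × ¬ Matched M (inj₁ a)
  size-witness {M} {M'} lt rewrite size≡count M | size≡count M' with count-witness lt
  ... | a , e1 , e2 = a , matchedᵇ⇒Matched M' a e1 , λ m → true≢false (Matched⇒matchedᵇ M a m) e2

  size-strict : ∀ {M M'} (a₀ : A I) → CoversApplicants M M' → ¬ Matched M (inj₁ a₀) → Matched M' (inj₁ a₀) →
    size I M < size I M'
  size-strict {M} {M'} a₀ h n₀ m₀ rewrite size≡count M | size≡count M' =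
    count-strict a₀ (λ a → matchedᵇ-mono a (h a)) (unmatchedᵇ M a₀ n₀) (Matched⇒matchedᵇ M' a₀ m₀)

  pairSel : A I → P I → Sel I
  pairSel a' p' a p = does (a' Data.Fin.≟ a) ∧ does (p' Data.Fin.≟ p)

  edgeSel : Vertex → Vertex → Sel I
  edgeSel (inj₁ a') (inj₂ p') = pairSel a' p'
  edgeSel (inj₂ p') (inj₁ a') = pairSel a' p'
  edgeSel (inj₁ _)  (inj₁ _)  = λ _ _ → false
  edgeSel (inj₂ _)  (inj₂ _)  = λ _ _ → false

  addEdge : Sel I → Vertex → Vertex → Sel I
  addEdge M u w a p = M a p ∨ edgeSel u w a p

  delEdge : Sel I → Vertex → Vertex → Sel I
  delEdge M u w a p = M a p ∧ not (edgeSel u w a p)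

  Joins-addEdge : ∀ M u w s t → Joins (addEdge M u w) s t ≡ Joins M s t ∨ Joins (edgeSel u w) s t
  Joins-addEdge M u w (inj₁ a) (inj₁ b) = refl
  Joins-addEdge M u w (inj₁ a) (inj₂ p) = refl
  Joins-addEdge M u w (inj₂ p) (inj₁ a) = refl
  Joins-addEdge M u w (inj₂ p) (inj₂ q) = refl

  Joins-delEdge : ∀ M u w s t → Joins (delEdge M u w) s t ≡ Joins M s t ∧ not (Joins (edgeSel u w) s t)
  Joins-delEdge M u w (inj₁ a) (inj₁ b) = refl
  Joins-delEdge M u w (inj₁ a) (inj₂ p) = refl
  Joins-delEdge M u w (inj₂ p) (inj₁ a) = refl
  Joins-delEdge M u w (inj₂ p) (inj₂ q) = refl

  SameEdge : Vertex → Vertex → Vertex → Vertex → Set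
  SameEdge u w s t = (s ≡ u × t ≡ w) ⊎ (s ≡ w × t ≡ u)

  ∧-true : ∀ {x y} → x ∧ y ≡ true → x ≡ true × y ≡ true
  ∧-true {true} {true} e = refl , refl

  does-true : ∀ {X : Set} (d : Dec X) → does d ≡ true → X
  does-true (yes x) e = x

  pairSel-true : ∀ a' p' a p → pairSel a' p' a p ≡ true → a' ≡ a × p' ≡ p
  pairSel-true a' p' a p e with ∧-true e
  ... | e₁ , e₂ = does-true (a' Data.Fin.≟ a) e₁ , does-true (p' Data.Fin.≟ p) e₂

  pairSel-hit : ∀ a p → pairSel a p a p ≡ true
  pairSel-hit a p rewrite dec-true (a Data.Fin.≟ a) refl | dec-true (p Data.Fin.≟ p) refl = refl

  edgeSel-joins : ∀ u w s t → Joins (edgeSel u w) s t ≡ true → SameEdge u w s t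
  edgeSel-joins (inj₁ a') (inj₂ p') (inj₁ a) (inj₂ p) e with pairSel-true a' p' a p e
  ... | refl , refl = inj₁ (refl , refl)
  edgeSel-joins (inj₁ a') (inj₂ p') (inj₂ p) (inj₁ a) e with pairSel-true a' p' a p e
  ... | refl , refl = inj₂ (refl , refl)
  edgeSel-joins (inj₂ p') (inj₁ a') (inj₁ a) (inj₂ p) e with pairSel-true a' p' a p e
  ... | refl , refl = inj₂ (refl , refl)
  edgeSel-joins (inj₂ p') (inj₁ a') (inj₂ p) (inj₁ a) e with pairSel-true a' p' a p e
  ... | refl , refl = inj₁ (refl , refl)

  edgeSel-hit : ∀ u w → Across u w → Joins (edgeSel u w) u w ≡ true
  edgeSel-hit (inj₁ a) (inj₂ p) _ = pairSel-hit a p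
  edgeSel-hit (inj₂ p) (inj₁ a) _ = pairSel-hit a p

  edgeSel-hit' : ∀ u w → Across u w → Joins (edgeSel u w) w u ≡ true
  edgeSel-hit' u w o = trans (Joins-sym (edgeSel u w) w u) (edgeSel-hit u w o)

  addEdge-joins : ∀ M u w s t → Joins (addEdge M u w) s t ≡ true → Joins M s t ≡ true ⊎ SameEdge u w s t
  addEdge-joins M u w s t e rewrite Joins-addEdge M u w s t with Joins M s t
  ... | true = inj₁ refl
  ... | false = inj₂ (edgeSel-joins u w s t e)

  addEdge-keeps : ∀ M u w s t → Joins M s t ≡ true → Joins (addEdge M u w) s t ≡ true
  addEdge-keeps M u w s t e rewrite Joins-addEdge M u w s t | e = refl

  addEdge-new : ∀ M u w → Across u w → Joins (addEdge M u w) u w ≡ true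
  addEdge-new M u w o rewrite Joins-addEdge M u w u w | edgeSel-hit u w o = ∨-zeroʳ _

  addEdge-new' : ∀ M u w → Across u w → Joins (addEdge M u w) w u ≡ true
  addEdge-new' M u w o = trans (Joins-sym (addEdge M u w) w u) (addEdge-new M u w o)

  delEdge-joins : ∀ M u w s t → Joins (delEdge M u w) s t ≡ true → Joins M s t ≡ true × ¬ SameEdge u w s t
  delEdge-joins M u w s t e with Joins M s t in em | Joins (edgeSel u w) s t in ei | Joins-delEdge M u w s t
  ... | true | false | _ = refl , λ se → true≢false (sm se) ei
    where
    o : Across s t
    o = Joins⇒Across M s t em
    sm : SameEdge u w s t → Joins (edgeSel u w) s t ≡ true
    sm (inj₁ (refl , refl)) = edgeSel-hit s t o
    sm (inj₂ (refl , refl)) = edgeSel-hit' t s (Across-sym o)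
  ... | true | true | d = ⊥-elim (true≢false e d)
  ... | false | _ | d = ⊥-elim (true≢false e d)

  delEdge-keeps : ∀ M u w s t → Joins M s t ≡ true → ¬ SameEdge u w s t → Joins (delEdge M u w) s t ≡ true
  delEdge-keeps M u w s t e n rewrite Joins-delEdge M u w s t | e with Joins (edgeSel u w) s t in ei
  ... | true = ⊥-elim (n (edgeSel-joins u w s t ei))
  ... | false = refl

  sym-sub : ∀ {K M M'} → IsSymMatching K M → (∀ s t → Joins M' s t ≡ true → Joins M s t ≡ true) → IsSymMatching K M'
  sym-sub (edges , functional) h = (λ s t e → edges s t (h s t e)) , λ s t t' e e' → functional s t t' (h s t e) (h s t' e')

  sym-delEdge : ∀ {K M} u w → IsSymMatching K M → IsSymMatching K (delEdge M u w)
  sym-delEdge {K} {M} u w vm = sym-sub vm λ s t e → proj₁ (delEdge-joins M u w s t e)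

  sym-addEdge : ∀ {K M} u w → IsSymMatching K M → Adj I K u w → ¬ Matched M u → ¬ Matched M w → IsSymMatching K (addEdge M u w)
  sym-addEdge {K} {M} u w (edges , functional) adj nu nw = edges' , functional'
    where
    edges' : ∀ s t → Joins (addEdge M u w) s t ≡ true → Adj I K s t
    edges' s t e with addEdge-joins M u w s t e
    ... | inj₁ e' = edges s t e'
    ... | inj₂ (inj₁ (refl , refl)) = adj
    ... | inj₂ (inj₂ (refl , refl)) = Adj-sym K u w adj
    functional' : ∀ s t t' → Joins (addEdge M u w) s t ≡ true → Joins (addEdge M u w) s t' ≡ true → t ≡ t'
    functional' s t t' e e' with addEdge-joins M u w s t e | addEdge-joins M u w s t' e'
    ... | inj₁ x | inj₁ y = functional s t t' x y
    ... | inj₁ x | inj₂ (inj₁ (refl , refl)) = ⊥-elim (nu (t , x))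
    ... | inj₁ x | inj₂ (inj₂ (refl , refl)) = ⊥-elim (nw (t , x))
    ... | inj₂ (inj₁ (refl , refl)) | inj₁ y = ⊥-elim (nu (t' , y))
    ... | inj₂ (inj₂ (refl , refl)) | inj₁ y = ⊥-elim (nw (t' , y))
    ... | inj₂ (inj₁ (refl , refl)) | inj₂ (inj₁ (_ , refl)) = refl
    ... | inj₂ (inj₂ (refl , refl)) | inj₂ (inj₂ (_ , refl)) = refl
    ... | inj₂ (inj₁ (refl , refl)) | inj₂ (inj₂ (refl , refl)) = ⊥-elim (Across-irrefl (Adj⇒Across K s t adj))
    ... | inj₂ (inj₂ (refl , refl)) | inj₂ (inj₁ (refl , refl)) = ⊥-elim (Across-irrefl (Adj⇒Across K t s adj))

  matched-addEdge : ∀ M u w s → Matched (addEdge M u w) s → Matched M s ⊎ (s ≡ u ⊎ s ≡ w)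
  matched-addEdge M u w s (t , e) with addEdge-joins M u w s t e
  ... | inj₁ x = inj₁ (t , x)
  ... | inj₂ (inj₁ (refl , _)) = inj₂ (inj₁ refl)
  ... | inj₂ (inj₂ (refl , _)) = inj₂ (inj₂ refl)

  matched-addEdge-old : ∀ M u w s → Matched M s → Matched (addEdge M u w) s
  matched-addEdge-old M u w s (t , e) = t , addEdge-keeps M u w s t e

  matched-addEdge-u : ∀ M u w → Across u w → Matched (addEdge M u w) u
  matched-addEdge-u M u w o = w , addEdge-new M u w o

  matched-addEdge-w : ∀ M u w → Across u w → Matched (addEdge M u w) w
  matched-addEdge-w M u w o = u , addEdge-new' M u w o

  matched-delEdge : ∀ M u w s → Matched (delEdge M u w) s → Matched M s
  matched-delEdge M u w s (t , e) = t , proj₁ (delEdge-joins M u w s t e)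

  matched-delEdge-old : ∀ M u w s → s ≢ u → s ≢ w → Matched M s → Matched (delEdge M u w) s
  matched-delEdge-old M u w s nu nw (t , e) = t , delEdge-keeps M u w s t e λ { (inj₁ (x , _)) → nu x ; (inj₂ (x , _)) → nw x }

  delEdge-frees : ∀ {K} M u w → IsSymMatching K M → Joins M u w ≡ true → ¬ Matched (delEdge M u w) u
  delEdge-frees M u w (_ , functional) e (t , e') with delEdge-joins M u w u t e'
  ... | e'' , n with functional u w t e e''
  ... | refl = n (inj₁ (refl , refl))

  delEdge-frees' : ∀ {K} M u w → IsSymMatching K M → Joins M u w ≡ true → ¬ Matched (delEdge M u w) w
  delEdge-frees' M u w (_ , functional) e (t , e') with delEdge-joins M u w w t e'
  ... | e'' , n with functional w u t (trans (Joins-sym M w u) e) e''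
  ... | refl = n (inj₂ (refl , refl))

  size-add : ∀ M u w → Across u w → ¬ Matched M u → ¬ Matched M w → size I (addEdge M u w) ≡ suc (size I M)
  size-add M (inj₁ a₀) (inj₂ p₀) o nu nw =
    size-point a₀ nu (matched-addEdge-u M (inj₁ a₀) (inj₂ p₀) o)
      (λ a ne m → matched-addEdge-old M (inj₁ a₀) (inj₂ p₀) (inj₁ a) m)
      (λ a ne m → case (matched-addEdge M (inj₁ a₀) (inj₂ p₀) (inj₁ a) m) ne)
    where
    case : ∀ {a} → Matched M (inj₁ a) ⊎ ((Vertex ∋ inj₁ a) ≡ inj₁ a₀ ⊎ (Vertex ∋ inj₁ a) ≡ inj₂ p₀) → a ≢ a₀ → Matched M (inj₁ a)
    case (inj₁ m) ne = m
    case (inj₂ (inj₁ refl)) ne = ⊥-elim (ne refl)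
    case (inj₂ (inj₂ ())) ne
  size-add M (inj₂ p₀) (inj₁ a₀) o nu nw =
    size-point a₀ nw (matched-addEdge-w M (inj₂ p₀) (inj₁ a₀) o)
      (λ a ne m → matched-addEdge-old M (inj₂ p₀) (inj₁ a₀) (inj₁ a) m)
      (λ a ne m → case (matched-addEdge M (inj₂ p₀) (inj₁ a₀) (inj₁ a) m) ne)
    where
    case : ∀ {a} → Matched M (inj₁ a) ⊎ ((Vertex ∋ inj₁ a) ≡ inj₂ p₀ ⊎ (Vertex ∋ inj₁ a) ≡ inj₁ a₀) → a ≢ a₀ → Matched M (inj₁ a)
    case (inj₁ m) ne = m
    case (inj₂ (inj₂ refl)) ne = ⊥-elim (ne refl)
    case (inj₂ (inj₁ ()))  ne

  size-del : ∀ {K} M u w → IsSymMatching K M → Joins M u w ≡ true → size I M ≡ suc (size I (delEdge M u w))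
  size-del M (inj₁ a₀) (inj₂ p₀) vm e =
    size-point a₀ (delEdge-frees M (inj₁ a₀) (inj₂ p₀) vm e) (inj₂ p₀ , e)
      (λ a ne m → matched-delEdge M (inj₁ a₀) (inj₂ p₀) (inj₁ a) m)
      (λ a ne m → matched-delEdge-old M (inj₁ a₀) (inj₂ p₀) (inj₁ a) (ne ∘ inj₁-injective) (λ ()) m)
  size-del M (inj₂ p₀) (inj₁ a₀) vm e =
    size-point a₀ (delEdge-frees' M (inj₂ p₀) (inj₁ a₀) vm e) (inj₂ p₀ , trans (Joins-sym M (inj₁ a₀) (inj₂ p₀)) e)
      (λ a ne m → matched-delEdge M (inj₂ p₀) (inj₁ a₀) (inj₁ a) m)
      (λ a ne m → matched-delEdge-old M (inj₂ p₀) (inj₁ a₀) (inj₁ a) (λ ()) (ne ∘ inj₁-injective) m)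
  size-del M (inj₁ _) (inj₁ _) vm ()
  size-del M (inj₂ _) (inj₂ _) vm ()


  -- Inclusion and intersection of selections, used to measure progress when
  -- one matching is rearranged towards another.
  _⊆_ : Sel I → Sel I → Set
  M ⊆ M' = ∀ s t → Joins M s t ≡ true → Joins M' s t ≡ true

  Within : Sel I → Sel I → Sel I → Set
  Within N M L = ∀ s t → Joins L s t ≡ true → Joins N s t ≡ true ⊎ Joins M s t ≡ true

  _∩_ : Sel I → Sel I → Sel I
  (M ∩ N) a p = M a p ∧ N a p

  Joins-∩ : ∀ M N s t → Joins (M ∩ N) s t ≡ Joins M s t ∧ Joins N s t
  Joins-∩ M N (inj₁ a) (inj₁ b) = refl
  Joins-∩ M N (inj₁ a) (inj₂ p) = refl
  Joins-∩ M N (inj₂ p) (inj₁ a) = refl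
  Joins-∩ M N (inj₂ p) (inj₂ q) = refl

  ∩⁻ : ∀ M N s t → Joins (M ∩ N) s t ≡ true → Joins M s t ≡ true × Joins N s t ≡ true
  ∩⁻ M N s t e rewrite Joins-∩ M N s t = ∧-true e

  ∩⁺ : ∀ M N s t → Joins M s t ≡ true → Joins N s t ≡ true → Joins (M ∩ N) s t ≡ true
  ∩⁺ M N s t e₁ e₂ rewrite Joins-∩ M N s t | e₁ | e₂ = refl

  ∩-⊆ˡ : ∀ M N → (M ∩ N) ⊆ M
  ∩-⊆ˡ M N s t e = proj₁ (∩⁻ M N s t e)

  ⊆-size : ∀ {M M'} → M ⊆ M' → size I M ≤ size I M'
  ⊆-size h = size-mono λ a (t , e) → t , h (inj₁ a) t e

  ⊆-size-strict : ∀ {M M'} u w → M ⊆ M' → Across u w → ¬ Matched M u → ¬ Matched M w → Joins M' u w ≡ true →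
    size I M < size I M'
  ⊆-size-strict {M} {M'} (inj₁ a) w h o u-free w-free e = size-strict a (λ a (t , e) → t , h (inj₁ a) t e) u-free (w , e)
  ⊆-size-strict {M} {M'} (inj₂ p) (inj₁ a) h o u-free w-free e =
    size-strict a (λ a (t , e) → t , h (inj₁ a) t e) w-free (inj₂ p , trans (Joins-sym M' (inj₁ a) (inj₂ p)) e)

-- Let M and N be matchings of K, x a vertex free
-- in N and v a vertex free in M with xv an edge of K.  Walk from v to x, then
-- along the M-edge at x to y, along the N-edge at y to x₂, and so on.  Since M
-- loses an edge at every step the walk ends, and at its end either M can be
-- augmented (outcome 1), or N can be augmented (outcome 2), or, if a vertex p
-- free in M was designated "protected" and the walk reaches it, N can be
-- rearranged to a matching of the same size leaving p free (outcome 3).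
module Walk (I : Instance) (K : Graph I) where

  open import Data.Nat using (zero; suc)
  open import Data.Nat.Properties using (suc-injective; 0≢1+n)
  open import Data.Maybe using (Maybe; just; nothing)
  open import Data.Product using (Σ; _×_; _,_; proj₁; proj₂)
  open import Data.Sum using (_⊎_; inj₁; inj₂)
  open import Data.Empty using (⊥; ⊥-elim)
  open import Data.Unit using (⊤; tt)
  open import Data.Bool using (true)
  open import Relation.Binary.PropositionalEquality
  open import Relation.Nullary using (¬_; yes; no)
  open Matchings I

  SameSide : Vertex → Vertex → Set
  SameSide (inj₁ _) (inj₁ _) = ⊤
  SameSide (inj₂ _) (inj₂ _) = ⊤
  SameSide _        _        = ⊥

  SameSide-refl : ∀ s → SameSide s s
  SameSide-refl (inj₁ _) = tt
  SameSide-refl (inj₂ _) = tt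

  across²⇒SameSide : ∀ {x y z} → Across x y → Across y z → SameSide z x
  across²⇒SameSide {inj₁ _} {inj₂ _} {inj₁ _} _ _ = tt
  across²⇒SameSide {inj₂ _} {inj₁ _} {inj₂ _} _ _ = tt

  SameSide-trans : ∀ {x y z} → SameSide x y → SameSide y z → SameSide x z
  SameSide-trans {inj₁ _} {inj₁ _} {inj₁ _} _ _ = tt
  SameSide-trans {inj₂ _} {inj₂ _} {inj₂ _} _ _ = tt

  SameSide⇒¬Across : ∀ {x y} → SameSide x y → Across y x → ⊥
  SameSide⇒¬Across {inj₁ _} {inj₁ _} _ ()
  SameSide⇒¬Across {inj₂ _} {inj₂ _} _ ()

  KeepsFree : Sel I → Maybe Vertex → Set
  KeepsFree M nothing  = ⊤
  KeepsFree M (just p) = ¬ Matched M p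

  Differs : Maybe Vertex → Vertex → Set
  Differs nothing  x = ⊤
  Differs (just p) x = p ≢ x

  Protectable : Sel I → Vertex → Maybe Vertex → Set
  Protectable M v po = KeepsFree M po × Differs po v

  GrowsFirst : Sel I → Sel I → Vertex → Vertex → Maybe Vertex → Set
  GrowsFirst M N x v po = Σ (Sel I) λ M⁺ → IsSymMatching K M⁺ × size I M⁺ ≡ suc (size I M) × KeepsFree M⁺ po ×
    (∀ w → Matched M⁺ w → Matched M w ⊎ (w ≡ v ⊎ SameSide w x)) ×
    (∀ s t → Joins M⁺ s t ≡ true → Joins M s t ≡ true ⊎ (Joins N s t ≡ true ⊎ SameEdge x v s t))

  GrowsSecond : Sel I → Sel I → Set
  GrowsSecond M N = Σ (Sel I) λ N⁺ → IsSymMatching K N⁺ × size I N⁺ ≡ suc (size I N) × Within N M N⁺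

  FreesProtected : Sel I → Sel I → Maybe Vertex → Set
  FreesProtected M N nothing  = ⊥
  FreesProtected M N (just p) =
    Σ (Sel I) λ N' → IsSymMatching K N' × size I N' ≡ size I N × ¬ Matched N' p × Within N M N'

  WalkOutcome : Sel I → Sel I → Vertex → Vertex → Maybe Vertex → Set
  WalkOutcome M N x v po = GrowsFirst M N x v po ⊎ (GrowsSecond M N ⊎ FreesProtected M N po)

  keepsFree-addEdge : ∀ M x v po → Differs po v → Differs po x → KeepsFree M po → KeepsFree (addEdge M x v) po
  keepsFree-addEdge M x v nothing  _ _ _ = tt
  keepsFree-addEdge M x v (just p) p≢v p≢x p-free m with matched-addEdge M x v p m
  ... | inj₁ m'          = p-free m'
  ... | inj₂ (inj₁ p≡x)  = p≢x p≡x
  ... | inj₂ (inj₂ p≡v)  = p≢v p≡v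

  grow-first-here : ∀ M N x v po → IsSymMatching K M → Adj I K x v → ¬ Matched M x → ¬ Matched M v →
    Protectable M v po → Differs po x → GrowsFirst M N x v po
  grow-first-here M N x v po isM xv x-free v-free prot p≢x =
    addEdge M x v , sym-addEdge x v isM xv x-free v-free ,
    size-add M x v (Adj⇒Across K x v xv) x-free v-free ,
    keepsFree-addEdge M x v po (proj₂ prot) p≢x (proj₁ prot) , newMatched , newEdges
    where
    newMatched : ∀ w → Matched (addEdge M x v) w → Matched M w ⊎ (w ≡ v ⊎ SameSide w x)
    newMatched w m with matched-addEdge M x v w m
    ... | inj₁ m'          = inj₁ m'
    ... | inj₂ (inj₁ refl) = inj₂ (inj₂ (SameSide-refl w))
    ... | inj₂ (inj₂ refl) = inj₂ (inj₁ refl)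
    newEdges : ∀ s t → Joins (addEdge M x v) s t ≡ true → Joins M s t ≡ true ⊎ (Joins N s t ≡ true ⊎ SameEdge x v s t)
    newEdges s t e with addEdge-joins M x v s t e
    ... | inj₁ e' = inj₁ e'
    ... | inj₂ se = inj₂ (inj₂ se)

  grow-second-here : ∀ M N x y → IsSymMatching K M → IsSymMatching K N → ¬ Matched N x → ¬ Matched N y →
    Joins M x y ≡ true → GrowsSecond M N
  grow-second-here M N x y isM isN x-free y-free xy =
    addEdge N x y , sym-addEdge x y isN (proj₁ isM x y xy) x-free y-free ,
    size-add N x y (Joins⇒Across M x y xy) x-free y-free , newEdges
    where
    newEdges : Within N M (addEdge N x y)
    newEdges s t e with addEdge-joins N x y s t e
    ... | inj₁ e'                   = inj₁ e'
    ... | inj₂ (inj₁ (refl , refl)) = inj₂ xy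
    ... | inj₂ (inj₂ (refl , refl)) = inj₂ (trans (Joins-sym M s t) xy)

  -- One step of the walk: x is matched to y in M and y to x₂ in N.  Removing
  -- these two edges gives matchings M₁, N₁ for which the walk continues from
  -- the edge x₂y; any outcome for M₁, N₁ lifts back to M, N.
  module Step (M N : Sel I) (x v y x₂ : Vertex) (isM : IsSymMatching K M) (isN : IsSymMatching K N)
              (x-free : ¬ Matched N x) (v-free : ¬ Matched M v) (xv : Adj I K x v)
              (xy : Joins M x y ≡ true) (yx₂ : Joins N y x₂ ≡ true) where

    M₁ N₁ : Sel I
    M₁ = delEdge M x y
    N₁ = delEdge N y x₂

    size-M : size I M ≡ suc (size I M₁)
    size-M = size-del M x y isM xy

    size-N : size I N ≡ suc (size I N₁)
    size-N = size-del N y x₂ isN yx₂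

    isM₁ : IsSymMatching K M₁
    isM₁ = sym-delEdge x y isM

    isN₁ : IsSymMatching K N₁
    isN₁ = sym-delEdge y x₂ isN

    x₂-free : ¬ Matched N₁ x₂
    x₂-free = delEdge-frees' N y x₂ isN yx₂

    y-free : ¬ Matched M₁ y
    y-free = delEdge-frees' M x y isM xy

    x₂y : Adj I K x₂ y
    x₂y = Adj-sym K y x₂ (proj₁ isN y x₂ yx₂)

    x⟷y : Across x y
    x⟷y = Joins⇒Across M x y xy

    y⟷x₂ : Across y x₂
    y⟷x₂ = Joins⇒Across N y x₂ yx₂

    y≢v : y ≢ v
    y≢v refl = v-free (Matched-sym M x y xy)

    x≢x₂ : x ≢ x₂
    x≢x₂ refl = x-free (Matched-sym N y x₂ yx₂)

    protectable₁ : ∀ po → Protectable M v po → Protectable M₁ y po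
    protectable₁ nothing  _ = tt , tt
    protectable₁ (just p) (p-free , _) =
      (λ m → p-free (matched-delEdge M x y p m)) , λ { refl → p-free (Matched-sym M x y xy) }

    x-free-M₁ : ¬ Matched M₁ x
    x-free-M₁ (t , e) with delEdge-joins M x y x t e
    ... | e' , not-xy with proj₂ isM x y t xy e'
    ... | refl = not-xy (inj₁ (refl , refl))

    x-free-N₁ : ¬ Matched N₁ x
    x-free-N₁ (t , e) = x-free (t , proj₁ (delEdge-joins N y x₂ x t e))

    y-free-N₁ : ¬ Matched N₁ y
    y-free-N₁ (t , e) with delEdge-joins N y x₂ y t e
    ... | e' , not-yx₂ with proj₂ isN y x₂ t yx₂ e'
    ... | refl = not-yx₂ (inj₁ (refl , refl))

    free-within : ∀ {L} w → ¬ Matched N₁ w → ¬ Matched M₁ w → Within N₁ M₁ L → ¬ Matched L w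
    free-within w freeN freeM within (t , e) with within w t e
    ... | inj₁ e' = freeN (t , e')
    ... | inj₂ e' = freeM (t , e')

    reinsert : ∀ L → IsSymMatching K L → Within N₁ M₁ L →
      IsSymMatching K (addEdge L x y) × size I (addEdge L x y) ≡ suc (size I L) × Within N M (addEdge L x y)
    reinsert L isL within =
      sym-addEdge x y isL (proj₁ isM x y xy) x-freeL y-freeL ,
      size-add L x y x⟷y x-freeL y-freeL , newEdges
      where
      x-freeL = free-within x x-free-N₁ x-free-M₁ within
      y-freeL = free-within y y-free-N₁ y-free within
      newEdges : Within N M (addEdge L x y)
      newEdges s t e with addEdge-joins L x y s t e
      ... | inj₂ (inj₁ (refl , refl)) = inj₂ xy
      ... | inj₂ (inj₂ (refl , refl)) = inj₂ (trans (Joins-sym M s t) xy)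
      ... | inj₁ e' with within s t e'
      ...   | inj₁ e'' = inj₁ (proj₁ (delEdge-joins N y x₂ s t e''))
      ...   | inj₂ e'' = inj₂ (proj₁ (delEdge-joins M x y s t e''))

    lift-second : GrowsSecond M₁ N₁ → GrowsSecond M N
    lift-second (N⁺ , isN⁺ , size⁺ , within) with reinsert N⁺ isN⁺ within
    ... | isL , sizeL , withinL = addEdge N⁺ x y , isL , trans sizeL (cong suc (trans size⁺ (sym size-N))) , withinL

    lift-protected : ∀ po → Protectable M v po → Differs po x → FreesProtected M₁ N₁ po → FreesProtected M N po
    lift-protected (just p) (p-free , _) p≢x (N' , isN' , size' , p-free' , within) with reinsert N' isN' within
    ... | isL , sizeL , withinL = addEdge N' x y , isL , trans sizeL (trans (cong suc size') (sym size-N)) , p-freeL , withinL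
      where
      p-freeL : ¬ Matched (addEdge N' x y) p
      p-freeL m with matched-addEdge N' x y p m
      ... | inj₁ m'          = p-free' m'
      ... | inj₂ (inj₁ p≡x)  = p≢x p≡x
      ... | inj₂ (inj₂ refl) = p-free (Matched-sym M x y xy)

    -- Putting xv into the augmented M₁ (the edge xy has been traded for xv and the path beyond).
    lift-first : ∀ po → Protectable M v po → Differs po x → GrowsFirst M₁ N₁ x₂ y po → GrowsFirst M N x v po
    lift-first po prot p≢x (M⁺ , isM⁺ , size⁺ , keeps⁺ , matched⁺ , edges⁺) =
      addEdge M⁺ x v , sym-addEdge x v isM⁺ xv x-freeM⁺ v-freeM⁺ ,
      trans (size-add M⁺ x v (Adj⇒Across K x v xv) x-freeM⁺ v-freeM⁺) (cong suc (trans size⁺ (sym size-M))) ,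
      keepsFree-addEdge M⁺ x v po (proj₂ prot) p≢x keeps⁺ , newMatched , newEdges
      where
      x-freeM⁺ : ¬ Matched M⁺ x
      x-freeM⁺ (t , e) with edges⁺ x t e
      ... | inj₁ e'                       = x-free-M₁ (t , e')
      ... | inj₂ (inj₁ e')                = x-free-N₁ (t , e')
      ... | inj₂ (inj₂ (inj₁ (x≡x₂ , _))) = x≢x₂ x≡x₂
      ... | inj₂ (inj₂ (inj₂ (x≡y , _)))  = Across⇒≢ x⟷y x≡y
      x₂-side : ∀ {w} → SameSide w x₂ → SameSide w x
      x₂-side ss = SameSide-trans ss (across²⇒SameSide x⟷y y⟷x₂)
      v-freeM⁺ : ¬ Matched M⁺ v
      v-freeM⁺ m with matched⁺ v m
      ... | inj₁ m'          = v-free (matched-delEdge M x y v m')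
      ... | inj₂ (inj₁ v≡y)  = y≢v (sym v≡y)
      ... | inj₂ (inj₂ ss)   = SameSide⇒¬Across (x₂-side ss) (Adj⇒Across K x v xv)
      newMatched : ∀ w → Matched (addEdge M⁺ x v) w → Matched M w ⊎ (w ≡ v ⊎ SameSide w x)
      newMatched w m with matched-addEdge M⁺ x v w m
      ... | inj₂ (inj₁ refl) = inj₂ (inj₂ (SameSide-refl w))
      ... | inj₂ (inj₂ refl) = inj₂ (inj₁ refl)
      ... | inj₁ m' with matched⁺ w m'
      ...   | inj₁ m''         = inj₁ (matched-delEdge M x y w m'')
      ...   | inj₂ (inj₁ refl) = inj₁ (Matched-sym M x y xy)
      ...   | inj₂ (inj₂ ss)   = inj₂ (inj₂ (x₂-side ss))
      newEdges : ∀ s t → Joins (addEdge M⁺ x v) s t ≡ true → Joins M s t ≡ true ⊎ (Joins N s t ≡ true ⊎ SameEdge x v s t)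
      newEdges s t e with addEdge-joins M⁺ x v s t e
      ... | inj₂ se = inj₂ (inj₂ se)
      ... | inj₁ e' with edges⁺ s t e'
      ...   | inj₁ e''                          = inj₁ (proj₁ (delEdge-joins M x y s t e''))
      ...   | inj₂ (inj₁ e'')                   = inj₂ (inj₁ (proj₁ (delEdge-joins N y x₂ s t e'')))
      ...   | inj₂ (inj₂ (inj₁ (refl , refl))) = inj₂ (inj₁ (trans (Joins-sym N x₂ y) yx₂))
      ...   | inj₂ (inj₂ (inj₂ (refl , refl))) = inj₂ (inj₁ yx₂)

    lift : ∀ po → Protectable M v po → Differs po x → WalkOutcome M₁ N₁ x₂ y po → WalkOutcome M N x v po
    lift po prot p≢x (inj₁ first)            = inj₁ (lift-first po prot p≢x first)
    lift po prot p≢x (inj₂ (inj₁ second))    = inj₂ (inj₁ (lift-second second))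
    lift po prot p≢x (inj₂ (inj₂ protected)) = inj₂ (inj₂ (lift-protected po prot p≢x protected))

  mutual
    alternatingWalk : ∀ n M N x v po → size I M ≡ n → IsSymMatching K M → IsSymMatching K N →
      ¬ Matched N x → ¬ Matched M v → Adj I K x v → Protectable M v po → WalkOutcome M N x v po
    alternatingWalk n M N x v (just p) sz isM isN x-free v-free xv prot with p ≟V x
    ... | yes refl = inj₂ (inj₂ (N , isN , refl , x-free , λ s t e → inj₁ e))
    ... | no p≢x   = alternatingWalk′ n M N x v (just p) sz isM isN x-free v-free xv prot p≢x
    alternatingWalk n M N x v nothing sz isM isN x-free v-free xv prot =
      alternatingWalk′ n M N x v nothing sz isM isN x-free v-free xv prot tt

    alternatingWalk′ : ∀ n M N x v po → size I M ≡ n → IsSymMatching K M → IsSymMatching K N →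
      ¬ Matched N x → ¬ Matched M v → Adj I K x v → Protectable M v po → Differs po x → WalkOutcome M N x v po
    alternatingWalk′ n M N x v po sz isM isN x-free v-free xv prot p≢x with Matched? M x
    ... | no x-freeM = inj₁ (grow-first-here M N x v po isM xv x-freeM v-free prot p≢x)
    ... | yes (y , xy) with Matched? N y
    ...   | no y-freeN = inj₂ (inj₁ (grow-second-here M N x y isM isN x-free y-freeN xy))
    ...   | yes (x₂ , yx₂) with n
    ...     | zero  = ⊥-elim (0≢1+n (trans (sym sz) size-M))
      where open Step M N x v y x₂ isM isN x-free v-free xv xy yx₂
    ...     | suc k = lift po prot p≢x
                        (alternatingWalk k M₁ N₁ x₂ y po (suc-injective (trans (sym size-M) sz))
                           isM₁ isN₁ x₂-free y-free x₂y (protectable₁ po prot))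
      where open Step M N x v y x₂ isM isN x-free v-free xv xy yx₂

-- Sliding a
-- matching along an alternating path from a free vertex shows that an even
-- vertex is left free by some maximum matching, and that an odd vertex has a
-- neighbour left free by some maximum matching.  Combined with the
-- alternating-walk lemma this yields the two structural facts used for the
-- reduced graphs: a vertex left free by a maximum matching is even, and if an
-- odd vertex is matched to w then some maximum matching leaves w free.
module EvenOdd (I : Instance) (K : Graph I) where

  open import Data.Nat using (suc; _≤_)
  open import Data.Nat.Properties using (1+n≰n)
  open import Data.Bool using (Bool; true; false; _∨_; _∧_; not)
  open import Data.Bool.Properties using (not-involutive)
  open import Data.Maybe using (just; nothing)
  open import Data.List using ([]; _∷_; length)
  open import Data.List.Relation.Unary.All using (All; []; _∷_)
  open import Data.List.Relation.Unary.Unique.Propositional using (Unique)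
  open import Data.List.Relation.Unary.AllPairs using ([]; _∷_)
  open import Data.Product using (Σ; _×_; _,_; proj₁)
  open import Data.Sum using (inj₁; inj₂)
  open import Data.Empty using (⊥; ⊥-elim)
  open import Data.Unit using (tt)
  open import Relation.Binary.PropositionalEquality
  open import Relation.Nullary using (¬_)
  open import Function using (_∘_)
  open Matchings I
  open Walk I K

  IsMax : Sel I → Set
  IsMax M = IsMaximumMatching I K M

  max-of-size : ∀ {M M'} → IsMax M → IsSymMatching K M' → size I M' ≡ size I M → IsMax M'
  max-of-size (_ , maximal) isM' e = fromSym isM' , λ L isL → subst (size I L ≤_) (sym e) (maximal L isL)

  ¬larger : ∀ {M M'} → IsMax M → IsSymMatching K M' → size I M' ≡ suc (size I M) → ⊥
  ¬larger {M} (_ , maximal) isM' e = 1+n≰n (subst (_≤ size I M) e (maximal _ (fromSym isM')))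

  edgeSel-offˡ : ∀ u w s t → s ≢ u → t ≢ u → Joins (edgeSel u w) s t ≡ false
  edgeSel-offˡ u w s t s≢u t≢u with Joins (edgeSel u w) s t in e
  ... | false = refl
  ... | true with edgeSel-joins u w s t e
  ...   | inj₁ (s≡u , _) = ⊥-elim (s≢u s≡u)
  ...   | inj₂ (_ , t≡u) = ⊥-elim (t≢u t≡u)

  edgeSel-offʳ : ∀ u w s t → s ≢ w → t ≢ w → Joins (edgeSel u w) s t ≡ false
  edgeSel-offʳ u w s t s≢w t≢w with Joins (edgeSel u w) s t in e
  ... | false = refl
  ... | true with edgeSel-joins u w s t e
  ...   | inj₁ (_ , t≡w) = ⊥-elim (t≢w t≡w)
  ...   | inj₂ (s≡w , _) = ⊥-elim (s≢w s≡w)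

  slide : Sel I → Vertex → Vertex → Vertex → Sel I
  slide N q₀ q₁ q₂ = addEdge (delEdge N q₁ q₂) q₀ q₁

  slide-agrees : ∀ N q₀ q₁ q₂ s t → s ≢ q₁ → t ≢ q₁ → Joins (slide N q₀ q₁ q₂) s t ≡ Joins N s t
  slide-agrees N q₀ q₁ q₂ s t s≢q₁ t≢q₁
    rewrite Joins-addEdge (delEdge N q₁ q₂) q₀ q₁ s t | Joins-delEdge N q₁ q₂ s t
          | edgeSel-offˡ q₁ q₂ s t s≢q₁ t≢q₁ | edgeSel-offʳ q₀ q₁ s t s≢q₁ t≢q₁ = ∨-false (Joins N s t)
    where
    ∨-false : ∀ b → (b ∧ not false) ∨ false ≡ b
    ∨-false true  = refl
    ∨-false false = refl

  module Slide (N : Sel I) (q₀ q₁ q₂ : Vertex) (isN : IsSymMatching K N) (q₀-free : ¬ Matched N q₀)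
               (q₀q₁ : Adj I K q₀ q₁) (q₁q₂ : Joins N q₁ q₂ ≡ true) where

    private
      q₁-freeD : ¬ Matched (delEdge N q₁ q₂) q₁
      q₁-freeD = delEdge-frees N q₁ q₂ isN q₁q₂
      q₀-freeD : ¬ Matched (delEdge N q₁ q₂) q₀
      q₀-freeD m = q₀-free (matched-delEdge N q₁ q₂ q₀ m)

    slide-matching : IsSymMatching K (slide N q₀ q₁ q₂)
    slide-matching = sym-addEdge q₀ q₁ (sym-delEdge q₁ q₂ isN) q₀q₁ q₀-freeD q₁-freeD

    slide-size : size I (slide N q₀ q₁ q₂) ≡ size I N
    slide-size = trans (size-add (delEdge N q₁ q₂) q₀ q₁ (Adj⇒Across K q₀ q₁ q₀q₁) q₀-freeD q₁-freeD)
                       (sym (size-del N q₁ q₂ isN q₁q₂))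

    slide-frees : q₀ ≢ q₂ → q₁ ≢ q₂ → ¬ Matched (slide N q₀ q₁ q₂) q₂
    slide-frees q₀≢q₂ q₁≢q₂ m with matched-addEdge (delEdge N q₁ q₂) q₀ q₁ q₂ m
    ... | inj₁ m'          = delEdge-frees' N q₁ q₂ isN q₁q₂ m'
    ... | inj₂ (inj₁ q₂≡q₀) = q₀≢q₂ (sym q₂≡q₀)
    ... | inj₂ (inj₂ q₂≡q₁) = q₁≢q₂ (sym q₂≡q₁)

  altSteps-transfer : ∀ N N' q b s xs → (∀ s t → s ≢ q → t ≢ q → Joins N' s t ≡ Joins N s t) →
    All (q ≢_) (s ∷ xs) → AltSteps I K N b s xs → AltSteps I K N' b s xs
  altSteps-transfer N N' q b s []       agree avoid steps = tt
  altSteps-transfer N N' q b s (y ∷ ys) agree (q≢s ∷ avoid@(q≢y ∷ _)) (sy , e , steps) =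
    sy , trans (agree s y (q≢s ∘ sym) (q≢y ∘ sym)) e , altSteps-transfer N N' q (not b) y ys agree avoid steps

  parity-pred² : ∀ {n b} → Parity I (suc (suc n)) b → Parity I n b
  parity-pred² (p-suc (p-suc {b = b} p)) rewrite not-involutive b = p

  ShiftResult : Bool → Sel I → Vertex → Set
  ShiftResult true  N w = Σ (Sel I) λ N* → IsSymMatching K N* × size I N* ≡ size I N × ¬ Matched N* w
  ShiftResult false N w = Σ (Sel I) λ N* → IsSymMatching K N* × size I N* ≡ size I N ×
    Σ Vertex λ x → ¬ Matched N* x × Adj I K x w

  shiftResult-resize : ∀ b {N N'} w → size I N' ≡ size I N → ShiftResult b N' w → ShiftResult b N w
  shiftResult-resize true  w e (N* , isN* , size* , r) = N* , isN* , trans size* e , r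
  shiftResult-resize false w e (N* , isN* , size* , r) = N* , isN* , trans size* e , r

  shiftAlong : ∀ N q₀ vs b → IsSymMatching K N → ¬ Matched N q₀ → Unique (q₀ ∷ vs) →
    AltSteps I K N false q₀ vs → Parity I (length vs) b → ShiftResult b N (lastOf I q₀ vs)
  shiftAlong N q₀ [] .true isN q₀-free u steps p-zero = N , isN , refl , q₀-free
  shiftAlong N q₀ (q₁ ∷ []) .false isN q₀-free u (q₀q₁ , _ , tt) (p-suc p-zero) = N , isN , refl , q₀ , q₀-free , q₀q₁
  shiftAlong N q₀ (q₁ ∷ q₂ ∷ rest) b isN q₀-free ((q₀≢q₁ ∷ q₀≢q₂ ∷ _) ∷ (q₁≢q₂ ∷ q₁∉rest) ∷ unique)
             (q₀q₁ , _ , _ , q₁q₂ , steps) parity =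
    shiftResult-resize b (lastOf I q₂ rest) slide-size
      (shiftAlong (slide N q₀ q₁ q₂) q₂ rest b slide-matching (slide-frees q₀≢q₂ q₁≢q₂) unique
         (altSteps-transfer N _ q₁ false q₂ rest (slide-agrees N q₀ q₁ q₂) (q₁≢q₂ ∷ q₁∉rest) steps)
         (parity-pred² parity))
    where open Slide N q₀ q₁ q₂ isN q₀-free q₀q₁ q₁q₂

  even⇒freeable : ∀ w → Even I K w → Σ (Sel I) λ N → IsMax N × ¬ Matched N w
  even⇒freeable w (N , maxN , v₀ , vs , (v₀-free , unique , steps , end) , parity)
    with shiftAlong N v₀ vs true (toSym (proj₁ maxN)) (unmatched⇒¬Matched v₀-free) unique steps parity
  ... | N* , isN* , size* , w-free = N* , max-of-size maxN isN* size* , subst (λ z → ¬ Matched N* z) end w-free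

  free⇒even : ∀ M w → IsMax M → ¬ Matched M w → Even I K w
  free⇒even M w maxM w-free = M , maxM , w , [] , (¬Matched⇒unmatched w-free , [] ∷ [] , tt , refl) , p-zero

  -- A vertex left free by a maximum matching M is not odd: otherwise a maximum
  -- matching N* leaves a neighbour x of v free, and the alternating walk from
  -- the edge xv would augment M or N*.
  free⇒¬odd : ∀ M v → IsMax M → ¬ Matched M v → Odd I K v → ⊥
  free⇒¬odd M v maxM v-free (N , maxN , v₀ , vs , (v₀-free , unique , steps , end) , parity)
    with shiftAlong N v₀ vs false (toSym (proj₁ maxN)) (unmatched⇒¬Matched v₀-free) unique steps parity
  ... | N* , isN* , size* , x , x-free , xw
    with alternatingWalk (size I M) M N* x v nothing refl (toSym (proj₁ maxM)) isN* x-free v-free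
           (subst (Adj I K x) end xw) (tt , tt)
  ...   | inj₁ (M⁺ , isM⁺ , size⁺ , _)        = ¬larger maxM isM⁺ size⁺
  ...   | inj₂ (inj₁ (N⁺ , isN⁺ , size⁺ , _)) = ¬larger maxN isN⁺ (trans size⁺ (cong suc size*))

  free⇒¬oddOrUnreach : ∀ M v → IsMax M → ¬ Matched M v → ¬ OddOrUnreach I K v
  free⇒¬oddOrUnreach M v maxM v-free (inj₁ odd)      = free⇒¬odd M v maxM v-free odd
  free⇒¬oddOrUnreach M v maxM v-free (inj₂ (¬even , _)) = ¬even (free⇒even M v maxM v-free)

  -- If the maximum matching M joins an odd vertex a to w, some maximum matching
  -- leaves w free: run the alternating walk for M - aw with w protected.
  odd⇒partnerFreeable : ∀ M a w → IsMax M → Joins M a w ≡ true → Odd I K a →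
    Σ (Sel I) λ N → IsMax N × ¬ Matched N w
  odd⇒partnerFreeable M a w maxM aw (N , maxN , v₀ , vs , (v₀-free , unique , steps , end) , parity)
    with shiftAlong N v₀ vs false (toSym (proj₁ maxN)) (unmatched⇒¬Matched v₀-free) unique steps parity
  ... | N* , isN* , size* , x , x-free , xa
    with alternatingWalk (size I (delEdge M a w)) (delEdge M a w) N* x a (just w) refl
           (sym-delEdge a w isM) isN* x-free (delEdge-frees M a w isM aw) (subst (Adj I K x) end xa)
           (delEdge-frees' M a w isM aw , λ w≡a → Across⇒≢ (Joins⇒Across M a w aw) (sym w≡a))
    where isM = toSym (proj₁ maxM)
  ... | inj₁ (M⁺ , isM⁺ , size⁺ , w-free , _) =
    M⁺ , max-of-size maxM isM⁺ (trans size⁺ (sym (size-del M a w (toSym (proj₁ maxM)) aw))) , w-free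
  ... | inj₂ (inj₁ (N⁺ , isN⁺ , size⁺ , _))     = ⊥-elim (¬larger maxN isN⁺ (trans size⁺ (cong suc size*)))
  ... | inj₂ (inj₂ (N' , isN' , size' , w-free , _)) = N' , max-of-size maxN isN' (trans size' size*) , w-free

  freeable-neighbour⇒odd : ∀ N w u → IsMax N → ¬ Matched N w → Adj I K w u → Odd I K u
  freeable-neighbour⇒odd N w u maxN w-free wu =
    N , maxN , w , u ∷ [] ,
    (¬Matched⇒unmatched w-free , (Across⇒≢ (Adj⇒Across K w u wu) ∷ []) ∷ [] ∷ [] ,
     (wu , ≢true⇒false (λ e → w-free (u , e)) , tt) , refl) ,
    p-suc p-zero

-- Augmentation: if M and N are matchings of K with |M| < |N|, then M extends
-- to a matching of size |M| + 1 matching every vertex matched by M.  Starting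
-- from an applicant matched by N but not by M, follow N- and M-edges
-- alternately.  Either the walk ends in an M-augmenting path, or N can be
-- rearranged, keeping its size, so that it shares more edges with M; the
-- latter can happen at most |M| times.
module Augmentation (I : Instance) (K : Graph I) where

  open import Data.Nat using (zero; suc; _+_; _≤_; _<_; s≤s)
  open import Data.Nat.Properties
  open import Data.Product using (Σ; _×_; _,_; proj₁; proj₂)
  open import Data.Sum using (_⊎_; inj₁; inj₂)
  open import Data.Empty using (⊥; ⊥-elim)
  open import Data.Bool using (true)
  open import Relation.Binary.PropositionalEquality
  open import Relation.Nullary using (¬_; yes; no)
  open Matchings I
  open EvenOdd I K using (slide; module Slide)

  -- Fuel bookkeeping for the measure |M| - |M ∩ N|, which drops at every rearrangement.
  fuel-step : ∀ {m a b} f → m ≤ a + suc f → a < b → m ≤ b + f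
  fuel-step {m} {a} {b} f m≤ a<b = ≤-trans m≤ (subst (_≤ b + f) (sym (+-suc a f)) (+-monoˡ-≤ f a<b))

  fuel-empty : ∀ {m a b} → m ≤ a + 0 → a < b → b ≤ m → ⊥
  fuel-empty {m} m≤ a<b b≤m = <⇒≱ a<b (≤-trans b≤m (subst (m ≤_) (+-identityʳ _) m≤))

  Augments : Sel I → Sel I → Vertex → Set
  Augments M N x = Σ (Sel I) λ L → IsSymMatching K L × size I L ≡ suc (size I M) ×
    (∀ w → Matched M w → Matched L w) × Matched L x × Within M N L

  Improves : Sel I → Sel I → Set
  Improves M N = Σ (Sel I) λ N' → IsSymMatching K N' × size I N' ≡ size I N × Within N M N' ×
    size I (M ∩ N) < size I (M ∩ N')

  augments-here : ∀ M N x y → IsSymMatching K M → IsSymMatching K N → ¬ Matched M x → ¬ Matched M y →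
    Joins N x y ≡ true → Augments M N x
  augments-here M N x y isM isN x-free y-free xy =
    addEdge M x y , sym-addEdge x y isM (proj₁ isN x y xy) x-free y-free ,
    size-add M x y x⟷y x-free y-free ,
    (λ w m → matched-addEdge-old M x y w m) , matched-addEdge-u M x y x⟷y , newEdges
    where
    x⟷y = Joins⇒Across N x y xy
    newEdges : Within M N (addEdge M x y)
    newEdges s t e with addEdge-joins M x y s t e
    ... | inj₁ e'                   = inj₁ e'
    ... | inj₂ (inj₁ (refl , refl)) = inj₂ xy
    ... | inj₂ (inj₂ (refl , refl)) = inj₂ (trans (Joins-sym N s t) xy)

  improves-here : ∀ M N x y x₂ → IsSymMatching K M → IsSymMatching K N → ¬ Matched M x →
    Joins N x y ≡ true → Joins M y x₂ ≡ true → ¬ Matched N x₂ → Improves M N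
  improves-here M N x y x₂ isM isN x-free xy yx₂ x₂-free =
    N' , slide-matching , slide-size , newEdges , strict
    where
    yx : Joins N y x ≡ true
    yx = trans (Joins-sym N y x) xy
    x₂y : Adj I K x₂ y
    x₂y = Adj-sym K y x₂ (proj₁ isM y x₂ yx₂)
    open Slide N x₂ y x isN x₂-free x₂y yx
    N' = slide N x₂ y x
    y⟷x₂ = Joins⇒Across M y x₂ yx₂
    newEdges : Within N M N'
    newEdges s t e with addEdge-joins (delEdge N y x) x₂ y s t e
    ... | inj₁ e'                   = inj₁ (proj₁ (delEdge-joins N y x s t e'))
    ... | inj₂ (inj₁ (refl , refl)) = inj₂ (trans (Joins-sym M s t) yx₂)
    ... | inj₂ (inj₂ (refl , refl)) = inj₂ yx₂
    kept : (M ∩ N) ⊆ (M ∩ N')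
    kept s t e with ∩⁻ M N s t e
    ... | e₁ , e₂ = ∩⁺ M N' s t e₁ (addEdge-keeps (delEdge N y x) x₂ y s t (delEdge-keeps N y x s t e₂ not-yx))
      where
      not-yx : ¬ SameEdge y x s t
      not-yx (inj₁ (_ , refl)) = x-free (Matched-sym M s t e₁)
      not-yx (inj₂ (refl , _)) = x-free (t , e₁)
    x₂≢x : x₂ ≢ x
    x₂≢x refl = x-free (Matched-sym M y x₂ yx₂)
    y-free∩ : ¬ Matched (M ∩ N) y
    y-free∩ (t , e) with ∩⁻ M N y t e
    ... | e₁ , e₂ = x₂≢x (trans (proj₂ isM y x₂ t yx₂ e₁) (proj₂ isN y t x e₂ yx))
    x₂-free∩ : ¬ Matched (M ∩ N) x₂
    x₂-free∩ (t , e) = x₂-free (t , proj₂ (∩⁻ M N x₂ t e))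
    strict : size I (M ∩ N) < size I (M ∩ N')
    strict = ⊆-size-strict y x₂ kept y⟷x₂ y-free∩ x₂-free∩
               (∩⁺ M N' y x₂ yx₂ (trans (Joins-sym N' y x₂) (addEdge-new (delEdge N y x) x₂ y (Across-sym y⟷x₂))))

  -- One step: x –N– y –M– x₂ –N– y₂.  Deleting xy from N and yx₂ from M, the walk
  -- continues from x₂; the outcomes lift back by re-inserting xy.
  module Step (M N : Sel I) (x y x₂ : Vertex) (isM : IsSymMatching K M) (isN : IsSymMatching K N)
              (x-free : ¬ Matched M x) (xy : Joins N x y ≡ true) (yx₂ : Joins M y x₂ ≡ true) where

    M₁ N₁ : Sel I
    M₁ = delEdge M y x₂
    N₁ = delEdge N x y

    size-M : size I M ≡ suc (size I M₁)
    size-M = size-del M y x₂ isM yx₂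

    size-N : size I N ≡ suc (size I N₁)
    size-N = size-del N x y isN xy

    x⟷y : Across x y
    x⟷y = Joins⇒Across N x y xy

    y⟷x₂ : Across y x₂
    y⟷x₂ = Joins⇒Across M y x₂ yx₂

    x₂-free : ¬ Matched M₁ x₂
    x₂-free = delEdge-frees' M y x₂ isM yx₂

    x₂≢x : x₂ ≢ x
    x₂≢x refl = x-free (Matched-sym M y x₂ yx₂)

    keeps-x₂ : ∀ {y₂} → Joins N x₂ y₂ ≡ true → Joins N₁ x₂ y₂ ≡ true
    keeps-x₂ x₂y₂ = delEdge-keeps N x y _ _ x₂y₂ λ { (inj₁ (e , _)) → x₂≢x e ; (inj₂ (e , _)) → Across⇒≢ y⟷x₂ (sym e) }

    x-free-M₁ : ¬ Matched M₁ x
    x-free-M₁ (t , e) = x-free (t , proj₁ (delEdge-joins M y x₂ x t e))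

    x-free-N₁ : ¬ Matched N₁ x
    x-free-N₁ (t , e) with delEdge-joins N x y x t e
    ... | e' , not-xy with proj₂ isN x y t xy e'
    ... | refl = not-xy (inj₁ (refl , refl))

    y-free-M₁ : ¬ Matched M₁ y
    y-free-M₁ (t , e) with delEdge-joins M y x₂ y t e
    ... | e' , not-yx₂ with proj₂ isM y x₂ t yx₂ e'
    ... | refl = not-yx₂ (inj₁ (refl , refl))

    y-free-N₁ : ¬ Matched N₁ y
    y-free-N₁ (t , e) with delEdge-joins N x y y t e
    ... | e' , not-xy with proj₂ isN y x t (trans (Joins-sym N y x) xy) e'
    ... | refl = not-xy (inj₂ (refl , refl))

    free-within : ∀ {L} w → ¬ Matched M₁ w → ¬ Matched N₁ w → Within M₁ N₁ L → ¬ Matched L w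
    free-within w freeM freeN within (t , e) with within w t e
    ... | inj₁ e' = freeM (t , e')
    ... | inj₂ e' = freeN (t , e')

    reinsert : ∀ L → IsSymMatching K L → Within M₁ N₁ L →
      IsSymMatching K (addEdge L x y) × size I (addEdge L x y) ≡ suc (size I L) × Within M N (addEdge L x y)
    reinsert L isL within =
      sym-addEdge x y isL (proj₁ isN x y xy) x-freeL y-freeL , size-add L x y x⟷y x-freeL y-freeL , newEdges
      where
      x-freeL = free-within x x-free-M₁ x-free-N₁ within
      y-freeL = free-within y y-free-M₁ y-free-N₁ within
      newEdges : Within M N (addEdge L x y)
      newEdges s t e with addEdge-joins L x y s t e
      ... | inj₂ (inj₁ (refl , refl)) = inj₂ xy
      ... | inj₂ (inj₂ (refl , refl)) = inj₂ (trans (Joins-sym N s t) xy)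
      ... | inj₁ e' with within s t e'
      ...   | inj₁ e'' = inj₁ (proj₁ (delEdge-joins M y x₂ s t e''))
      ...   | inj₂ e'' = inj₂ (proj₁ (delEdge-joins N x y s t e''))

    swap-within : ∀ {A B L} → Within A B L → Within B A L
    swap-within within s t e with within s t e
    ... | inj₁ e' = inj₂ e'
    ... | inj₂ e' = inj₁ e'

    lift-augments : Augments M₁ N₁ x₂ → Augments M N x
    lift-augments (L₁ , isL₁ , size₁ , covers₁ , x₂-matched , within₁) with reinsert L₁ isL₁ within₁
    ... | isL , sizeL , withinL =
      addEdge L₁ x y , isL , trans sizeL (cong suc (trans size₁ (sym size-M))) ,
      covers , matched-addEdge-u L₁ x y x⟷y , withinL
      where
      covers : ∀ w → Matched M w → Matched (addEdge L₁ x y) w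
      covers w m with w ≟V y | w ≟V x₂
      ... | yes refl | _        = matched-addEdge-w L₁ x y x⟷y
      ... | no _     | yes refl = matched-addEdge-old L₁ x y w x₂-matched
      ... | no w≢y   | no w≢x₂  = matched-addEdge-old L₁ x y w (covers₁ w (matched-delEdge-old M y x₂ w w≢y w≢x₂ m))

    lift-improves : Improves M₁ N₁ → Improves M N
    lift-improves (N₁' , isN₁' , size₁ , within₁ , more₁) with reinsert N₁' isN₁' (swap-within within₁)
    ... | isL , sizeL , withinL =
      addEdge N₁' x y , isL , trans sizeL (trans (cong suc size₁) (sym size-N)) , swap-within withinL ,
      ≤-trans (s≤s (⊆-size shrink)) (≤-trans more₁ (⊆-size grow))
      where
      -- common edges of M and N avoid xy and yx₂, so they stay common
      shrink : (M ∩ N) ⊆ (M₁ ∩ N₁)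
      shrink s t e with ∩⁻ M N s t e
      ... | e₁ , e₂ = ∩⁺ M₁ N₁ s t (delEdge-keeps M y x₂ s t e₁ not-yx₂) (delEdge-keeps N x y s t e₂ not-xy)
        where
        yx : Joins N y x ≡ true
        yx = trans (Joins-sym N y x) xy
        not-yx₂ : ¬ SameEdge y x₂ s t
        not-yx₂ (inj₁ (refl , refl)) = x₂≢x (proj₂ isN y x₂ x e₂ yx)
        not-yx₂ (inj₂ (refl , refl)) = x₂≢x (proj₂ isN t s x (trans (Joins-sym N t s) e₂) yx)
        not-xy : ¬ SameEdge x y s t
        not-xy (inj₁ (refl , refl)) = x-free (t , e₁)
        not-xy (inj₂ (refl , refl)) = x-free (Matched-sym M s t e₁)
      grow : (M₁ ∩ N₁') ⊆ (M ∩ addEdge N₁' x y)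
      grow s t e with ∩⁻ M₁ N₁' s t e
      ... | e₁ , e₂ = ∩⁺ M _ s t (proj₁ (delEdge-joins M y x₂ s t e₁)) (addEdge-keeps N₁' x y s t e₂)

    lift : Augments M₁ N₁ x₂ ⊎ Improves M₁ N₁ → Augments M N x ⊎ Improves M N
    lift (inj₁ augments) = inj₁ (lift-augments augments)
    lift (inj₂ improves) = inj₂ (lift-improves improves)

  augmentingWalk : ∀ n M N x → size I M ≡ n → IsSymMatching K M → IsSymMatching K N →
    ¬ Matched M x → Matched N x → Augments M N x ⊎ Improves M N
  augmentingWalk n M N x sz isM isN x-free (y , xy) with Matched? M y
  ... | no y-free = inj₁ (augments-here M N x y isM isN x-free y-free xy)
  ... | yes (x₂ , yx₂) with Matched? N x₂
  ...   | no x₂-free = inj₂ (improves-here M N x y x₂ isM isN x-free xy yx₂ x₂-free)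
  ...   | yes (y₂ , x₂y₂) with n
  ...     | zero  = ⊥-elim (0≢1+n (trans (sym sz) size-M))
    where open Step M N x y x₂ isM isN x-free xy yx₂
  ...     | suc k = lift (augmentingWalk k M₁ N₁ x₂ (suc-injective (trans (sym size-M) sz))
                            (sym-delEdge y x₂ isM) (sym-delEdge x y isN) x₂-free (y₂ , keeps-x₂ x₂y₂))
    where open Step M N x y x₂ isM isN x-free xy yx₂

  Augmentation : Sel I → Set
  Augmentation M = Σ (Sel I) λ L → IsSymMatching K L × size I L ≡ suc (size I M) × (∀ w → Matched M w → Matched L w)

  augment-fuel : ∀ f M N → size I M ≤ size I (M ∩ N) + f → IsSymMatching K M → IsSymMatching K N →
    size I M < size I N → Augmentation M
  augment-fuel f M N fuel isM isN M<N with size-witness M<N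
  ... | a , a-matchedN , a-freeM with augmentingWalk (size I M) M N (inj₁ a) refl isM isN a-freeM a-matchedN
  ...   | inj₁ (L , isL , sizeL , covers , _) = L , isL , sizeL , covers
  ...   | inj₂ (N' , isN' , size' , _ , more) with f
  ...     | zero   = ⊥-elim (fuel-empty fuel more (⊆-size (∩-⊆ˡ M N')))
  ...     | suc f' = augment-fuel f' M N' (fuel-step f' fuel more) isM isN' (subst (size I M <_) (sym size') M<N)

  augment : ∀ M N → IsSymMatching K M → IsSymMatching K N → size I M < size I N → Augmentation M
  augment M N = augment-fuel (size I M) M N (m≤n+m _ _)

-- Let M be a maximum matching of K and L a matching of K
-- which never joins an odd vertex to an odd or unreachable one, and which
-- matches every odd or unreachable vertex.  Then L is maximum too.  If it were
-- smaller, some applicant w₀ matched by M to w₁ would be free in L; w₀ is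
-- even, so w₁ is odd and L matches it to a vertex w₂ that is even; sliding L
-- along w₀ w₁ w₂ keeps all hypotheses and the size, and makes L share one more
-- edge with M, which cannot go on forever.
module Cover (I : Instance) (K : Graph I) where

  open import Data.Nat using (zero; suc; _+_; _≤_; _<_; _≤?_)
  open import Data.Nat.Properties using (≰⇒>; <⇒≱; m≤n+m)
  open import Data.Product using (_,_; proj₁; proj₂)
  open import Data.Sum using (inj₁; inj₂)
  open import Data.Empty using (⊥; ⊥-elim)
  open import Data.Bool using (true)
  open import Relation.Binary.PropositionalEquality
  open import Relation.Nullary using (¬_; yes; no)
  open Matchings I
  open EvenOdd I K
  open Augmentation I K using (fuel-step; fuel-empty)

  NoOddEdge : Sel I → Set
  NoOddEdge L = ∀ s t → Joins L s t ≡ true → Odd I K s → ¬ OddOrUnreach I K t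

  CoversOddUnreach : Sel I → Set
  CoversOddUnreach L = ∀ w → OddOrUnreach I K w → Matched L w

  module Exchange (M L : Sel I) (w₀ w₁ : Vertex) (maxM : IsMax M) (isL : IsSymMatching K L)
                  (noOdd : NoOddEdge L) (covers : CoversOddUnreach L)
                  (w₀w₁ : Joins M w₀ w₁ ≡ true) (w₀-free : ¬ Matched L w₀) (w₀-even : Even I K w₀) where

    isM : IsSymMatching K M
    isM = toSym (proj₁ maxM)

    w₀⟷w₁ : Across w₀ w₁
    w₀⟷w₁ = Joins⇒Across M w₀ w₁ w₀w₁

    w₀-notOU : ¬ OddOrUnreach I K w₀
    w₀-notOU ou = w₀-free (covers w₀ ou)

    w₁-odd : Odd I K w₁
    w₁-odd with even⇒freeable w₀ w₀-even
    ... | N , maxN , w₀-freeN = freeable-neighbour⇒odd N w₀ w₁ maxN w₀-freeN (proj₁ isM w₀ w₁ w₀w₁)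

    w₂ : Vertex
    w₂ = proj₁ (covers w₁ (inj₁ w₁-odd))

    w₁w₂ : Joins L w₁ w₂ ≡ true
    w₁w₂ = proj₂ (covers w₁ (inj₁ w₁-odd))

    w₂-notOU : ¬ OddOrUnreach I K w₂
    w₂-notOU = noOdd w₁ w₂ w₁w₂ w₁-odd

    open Slide L w₀ w₁ w₂ isL w₀-free (proj₁ isM w₀ w₁ w₀w₁) w₁w₂ public

    L₃ : Sel I
    L₃ = slide L w₀ w₁ w₂

    noOdd₃ : NoOddEdge L₃
    noOdd₃ s t e s-odd with addEdge-joins (delEdge L w₁ w₂) w₀ w₁ s t e
    ... | inj₁ e'                   = noOdd s t (proj₁ (delEdge-joins L w₁ w₂ s t e')) s-odd
    ... | inj₂ (inj₁ (refl , refl)) = ⊥-elim (w₀-notOU (inj₁ s-odd))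
    ... | inj₂ (inj₂ (refl , refl)) = w₀-notOU

    covers₃ : CoversOddUnreach L₃
    covers₃ w ou with w ≟V w₁ | w ≟V w₂
    ... | yes refl | _        = matched-addEdge-w (delEdge L w₁ w₂) w₀ w₁ w₀⟷w₁
    ... | no _     | yes refl = ⊥-elim (w₂-notOU ou)
    ... | no w≢w₁  | no w≢w₂  =
      matched-addEdge-old (delEdge L w₁ w₂) w₀ w₁ w (matched-delEdge-old L w₁ w₂ w w≢w₁ w≢w₂ (covers w ou))

    w₂≢w₀ : w₂ ≢ w₀
    w₂≢w₀ e = w₀-free (subst (Matched L) e (Matched-sym L w₁ w₂ w₁w₂))

    -- M ∩ L avoids the edge w₁w₂ (w₁ is matched to w₀ in M), so it stays inside M ∩ L₃.
    kept : (M ∩ L) ⊆ (M ∩ L₃)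
    kept s t e with ∩⁻ M L s t e
    ... | e₁ , e₂ = ∩⁺ M L₃ s t e₁ (addEdge-keeps (delEdge L w₁ w₂) w₀ w₁ s t (delEdge-keeps L w₁ w₂ s t e₂ not-w₁w₂))
      where
      not-w₁w₂ : ¬ SameEdge w₁ w₂ s t
      not-w₁w₂ (inj₁ (refl , refl)) = w₂≢w₀ (proj₂ isM s t w₀ e₁ (trans (Joins-sym M s w₀) w₀w₁))
      not-w₁w₂ (inj₂ (refl , refl)) =
        w₂≢w₀ (proj₂ isM t s w₀ (trans (Joins-sym M t s) e₁) (trans (Joins-sym M t w₀) w₀w₁))

    more : size I (M ∩ L) < size I (M ∩ L₃)
    more = ⊆-size-strict w₀ w₁ kept w₀⟷w₁ w₀-free∩ w₁-free∩
             (∩⁺ M L₃ w₀ w₁ w₀w₁ (addEdge-new (delEdge L w₁ w₂) w₀ w₁ w₀⟷w₁))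
      where
      w₀-free∩ : ¬ Matched (M ∩ L) w₀
      w₀-free∩ (t , e) = w₀-free (t , proj₂ (∩⁻ M L w₀ t e))
      w₁-free∩ : ¬ Matched (M ∩ L) w₁
      w₁-free∩ (t , e) with ∩⁻ M L w₁ t e
      ... | e₁ , e₂ = w₀-free (subst (Matched L) (proj₂ isM w₁ t w₀ e₁ (trans (Joins-sym M w₁ w₀) w₀w₁)) (Matched-sym L w₁ t e₂))

  cover-fuel : ∀ f M L → IsMax M → IsSymMatching K L → NoOddEdge L → CoversOddUnreach L →
    size I M ≤ size I (M ∩ L) + f → size I M ≤ size I L
  cover-fuel f M L maxM isL noOdd covers fuel with size I M ≤? size I L
  ... | yes M≤L = M≤L
  ... | no M≰L with size-witness (≰⇒> M≰L)
  ...   | a , (w₁ , w₀w₁) , w₀-free = ⊥-elim (¬¬even (exchange f fuel))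
    where
    ¬¬even : ¬ ¬ Even I K (inj₁ a)
    ¬¬even ¬even = w₀-free (covers (inj₁ a) (inj₂ (¬even , λ odd → w₀-free (covers (inj₁ a) (inj₁ odd)))))
    exchange : ∀ f → size I M ≤ size I (M ∩ L) + f → Even I K (inj₁ a) → ⊥
    exchange zero fuel even = fuel-empty fuel more (⊆-size (∩-⊆ˡ M L₃))
      where open Exchange M L (inj₁ a) w₁ maxM isL noOdd covers w₀w₁ w₀-free even
    exchange (suc f') fuel even =
      <⇒≱ (≰⇒> M≰L) (subst (size I M ≤_) slide-size
                       (cover-fuel f' M L₃ maxM slide-matching noOdd₃ covers₃ (fuel-step f' fuel more)))
      where open Exchange M L (inj₁ a) w₁ maxM isL noOdd covers w₀w₁ w₀-free even

  cover : ∀ M L → IsMax M → IsSymMatching K L → NoOddEdge L → CoversOddUnreach L → size I M ≤ size I L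
  cover M L maxM isL noOdd covers = cover-fuel (size I M) M L maxM isL noOdd covers (m≤n+m _ _)

-- For a matching X let cumulative X l be
-- the number of applicants matched by edges of rank ≤ l; it is the l-th prefix
-- sum of the signature of X.  Consequently, if Y matches at least as many
-- applicants as X with edges of rank ≤ l for every l ≤ m, and strictly more for
-- l = m, then the signature of Y is not lexicographically below that of X.
module Rank (I : Instance) where

  open import Data.Nat using (ℕ; zero; suc; _+_; _≤_; _<_; z≤n; s≤s)
  open import Data.Nat.Properties
  open import Data.Fin using (Fin; zero; suc; toℕ; fromℕ<)
  import Data.Fin
  open import Data.Fin.Properties using (toℕ-injective; toℕ-fromℕ<)
  open import Data.Bool using (Bool; true; false; _∨_; _∧_)
  open import Data.Bool.Properties using (∧-distribˡ-∨; ∧-zeroʳ)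
  open import Data.Bool.ListAction using (any)
  open import Data.Maybe using (Maybe; just; nothing)
  open import Data.Maybe.Properties using (just-injective)
  open import Data.List using (List; []; _∷_; tabulate; allFin)
  open import Data.List.Properties using (map-tabulate)
  open import Data.Product using (_,_)
  open import Data.Sum using (inj₁; inj₂)
  open import Data.Empty using (⊥; ⊥-elim)
  open import Function using (_∘_)
  open import Relation.Binary.PropositionalEquality
  open import Relation.Nullary using (¬_; yes; no)
  open Counting
  open Matchings I

  open Instance I

  -- The comparison m ≤ n as a structurally recursive boolean test.
  leᵇ : ℕ → ℕ → Bool
  leᵇ zero    n       = true
  leᵇ (suc m) zero    = false
  leᵇ (suc m) (suc n) = leᵇ m n

  leᵇ⇒≤ : ∀ m n → leᵇ m n ≡ true → m ≤ n
  leᵇ⇒≤ zero    n       e = z≤n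
  leᵇ⇒≤ (suc m) (suc n) e = s≤s (leᵇ⇒≤ m n e)

  ≤⇒leᵇ : ∀ m n → m ≤ n → leᵇ m n ≡ true
  ≤⇒leᵇ zero    n       _         = refl
  ≤⇒leᵇ (suc m) (suc n) (s≤s m≤n) = ≤⇒leᵇ m n m≤n

  atMost : ℕ → Maybe (Fin r) → Bool
  atMost k nothing  = false
  atMost k (just j) = leᵇ (rankℕ j) k

  atMost⇒RankLe : ∀ k a p → atMost k (rank a p) ≡ true → RankLe I k a p
  atMost⇒RankLe k a p e with rank a p
  ... | nothing = ⊥-elim (true≢false e refl)
  ... | just j  = j , refl , leᵇ⇒≤ (rankℕ j) k e

  RankLe⇒atMost : ∀ k a p → RankLe I k a p → atMost k (rank a p) ≡ true
  RankLe⇒atMost k a p (j , e , j≤k) rewrite e = ≤⇒leᵇ (rankℕ j) k j≤k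

  RankGt⇒¬atMost : ∀ k a p → RankGt I k a p → atMost k (rank a p) ≡ true → ⊥
  RankGt⇒¬atMost k a p (j , e , k<j) e' with atMost⇒RankLe k a p e'
  ... | j' , e'' , j'≤k with just-injective (trans (sym e) e'')
  ... | refl = <⇒≱ k<j j'≤k

  ¬atMost⇒RankGt : ∀ k k' a p → RankLe I k' a p → atMost k (rank a p) ≡ false → RankGt I k a p
  ¬atMost⇒RankGt k k' a p (j , e , _) e' = j , e , ≰⇒> j≰k
    where
    j≰k : ¬ rankℕ j ≤ k
    j≰k j≤k = true≢false (RankLe⇒atMost k a p (j , e , j≤k)) e'

  restrict : Sel I → ℕ → Sel I
  restrict X k a p = X a p ∧ atMost k (rank a p)

  matchedWithRank : Sel I → Fin r → A I → Bool
  matchedWithRank X j a = any (λ p → X a p ∧ hasRank I (rank a p) j) (allFin nP)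

  countRank≡count : ∀ X j → countRank I X j ≡ count (matchedWithRank X j)
  countRank≡count X j = length-filter-tabulate nA (matchedWithRank X j) (λ x → x)

  cumulative : Sel I → ℕ → ℕ
  cumulative X l = size I (restrict X l)

  cumulative-zero : ∀ X → cumulative X 0 ≡ 0
  cumulative-zero X rewrite size≡count (restrict X 0) = count-false λ a → none a (allFin nP)
    where
    none : ∀ a (ps : List (P I)) → any (λ p → X a p ∧ atMost 0 (rank a p)) ps ≡ false
    none a []       = refl
    none a (p ∷ ps) with rank a p
    ... | nothing rewrite ∧-zeroʳ (X a p) = none a ps
    ... | just _  rewrite ∧-zeroʳ (X a p) = none a ps

  atMost-suc : ∀ t (j : Fin r) x → toℕ j ≡ t → atMost (suc t) x ≡ atMost t x ∨ hasRank I x j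
  atMost-suc t j nothing  eq = refl
  atMost-suc t j (just k) eq with leᵇ (toℕ k) t in k≤t | leᵇ (suc (toℕ k)) t in k<t | k Data.Fin.≟ j
  ... | true  | true  | _        = refl
  ... | true  | false | yes _    = refl
  ... | true  | false | no k≢j   = ⊥-elim (k≢j (toℕ-injective (trans k≡t (sym eq))))
    where
    k≡t : toℕ k ≡ t
    k≡t = ≤-antisym (leᵇ⇒≤ _ _ k≤t) (≤-pred (≰⇒> (λ k<t' → true≢false (≤⇒leᵇ _ _ k<t') k<t)))
  ... | false | true  | _        = ⊥-elim (true≢false (≤⇒leᵇ _ _ (<⇒≤ (leᵇ⇒≤ (suc (toℕ k)) t k<t))) k≤t)
  ... | false | false | yes refl = ⊥-elim (true≢false (≤⇒leᵇ _ _ (≤-reflexive eq)) k≤t)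
  ... | false | false | no _     = refl

  Functional : Sel I → Set
  Functional X = ∀ a p p' → X a p ≡ true → X a p' ≡ true → p ≡ p'

  cumulative-suc : ∀ X t j → Functional X → toℕ j ≡ t → cumulative X (suc t) ≡ cumulative X t + countRank I X j
  cumulative-suc X t j functional eq
    rewrite size≡count (restrict X (suc t)) | size≡count (restrict X t) | countRank≡count X j =
    trans (count-cong split) (count-∨ disjoint)
    where
    split : ∀ a → matchedᵇ (restrict X (suc t)) a ≡ (matchedᵇ (restrict X t) a ∨ matchedWithRank X j a)
    split a = trans (any-cong (allFin nP) (λ p → trans (cong (X a p ∧_) (atMost-suc t j (rank a p) eq))
                                                       (∧-distribˡ-∨ (X a p) _ _)))
                    (any-∨ _ _ (allFin nP))
    disjoint : ∀ a → matchedᵇ (restrict X t) a ≡ true → matchedWithRank X j a ≡ true → ⊥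
    disjoint a e₁ e₂ with any-tabulate⁻ nP _ (λ x → x) e₁ | any-tabulate⁻ nP _ (λ x → x) e₂
    ... | p₁ , h₁ | p₂ , h₂ with ∧-true h₁ | ∧-true h₂
    ... | x₁ , r₁ | x₂ , r₂ with functional a p₁ p₂ x₁ x₂
    ... | refl with rank a p₁
    ... | nothing = true≢false r₁ refl
    ... | just k with k Data.Fin.≟ j
    ...   | no _     = true≢false r₂ refl
    ...   | yes refl = 1+n≰n (subst (λ z → suc z ≤ t) eq (leᵇ⇒≤ (rankℕ k) t r₁))

  prefixSum : ∀ n → (Fin n → ℕ) → ℕ → ℕ
  prefixSum n       f zero    = 0
  prefixSum zero    f (suc l) = 0
  prefixSum (suc n) f (suc l) = f zero + prefixSum n (f ∘ suc) l

  prefixSum-suc : ∀ n (f : Fin n → ℕ) (j : Fin n) l → toℕ j ≡ l → prefixSum n f (suc l) ≡ prefixSum n f l + f j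
  prefixSum-suc (suc n) f zero    .0               refl = +-identityʳ _
  prefixSum-suc (suc n) f (suc j) .(suc (toℕ j)) refl =
    trans (cong (f zero +_) (prefixSum-suc n (f ∘ suc) j (toℕ j) refl)) (sym (+-assoc (f zero) _ _))

  cumulative≡prefixSum : ∀ X → Functional X → ∀ l → l ≤ r → cumulative X l ≡ prefixSum r (countRank I X) l
  cumulative≡prefixSum X functional zero    _   = cumulative-zero X
  cumulative≡prefixSum X functional (suc l) l<r = begin
    cumulative X (suc l)                                ≡⟨ cumulative-suc X l j functional eq ⟩
    cumulative X l + countRank I X j                    ≡⟨ cong (_+ countRank I X j) (cumulative≡prefixSum X functional l (<⇒≤ l<r)) ⟩
    prefixSum r (countRank I X) l + countRank I X j     ≡⟨ prefixSum-suc r _ j l eq ⟨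
    prefixSum r (countRank I X) (suc l)                 ∎
    where
    open ≡-Reasoning
    j : Fin r
    j = fromℕ< l<r
    eq : toℕ j ≡ l
    eq = toℕ-fromℕ< l<r

  dominating⇒¬LexLe : ∀ n (x y : Fin n → ℕ) m → m ≤ n → (∀ l → l ≤ m → prefixSum n x l ≤ prefixSum n y l) →
    prefixSum n x m < prefixSum n y m → LexLe I (tabulate y) (tabulate x) → ⊥
  dominating⇒¬LexLe n       x y zero    _         dom ()     lex
  dominating⇒¬LexLe zero    x y (suc m) ()
  dominating⇒¬LexLe (suc n) x y (suc m) (s≤s m≤n) dom strict (inj₁ y₀<x₀) =
    <⇒≱ y₀<x₀ (subst₂ _≤_ (+-identityʳ _) (+-identityʳ _) (dom 1 (s≤s z≤n)))
  dominating⇒¬LexLe (suc n) x y (suc m) (s≤s m≤n) dom strict (inj₂ (y₀≡x₀ , lex)) =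
    dominating⇒¬LexLe n (x ∘ suc) (y ∘ suc) m m≤n dom' strict' lex
    where
    dom' : ∀ l → l ≤ m → prefixSum n (x ∘ suc) l ≤ prefixSum n (y ∘ suc) l
    dom' l l≤m = +-cancelˡ-≤ (x zero) _ _
      (subst (λ z → x zero + prefixSum n (x ∘ suc) l ≤ z + prefixSum n (y ∘ suc) l) y₀≡x₀ (dom (suc l) (s≤s l≤m)))
    strict' : prefixSum n (x ∘ suc) m < prefixSum n (y ∘ suc) m
    strict' = +-cancelˡ-< (x zero) _ _
      (subst (λ z → x zero + prefixSum n (x ∘ suc) m < z + prefixSum n (y ∘ suc) m) y₀≡x₀ strict)

  signature≡tabulate : ∀ X → signature I X ≡ tabulate (countRank I X)
  signature≡tabulate X = map-tabulate (λ x → x) (countRank I X)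

-- Every rank-maximal matching M lies in the reduced graph.  Write M≤ i for the
-- edges of M of rank ≤ i + 1 and G′ i for the graph G'_{i+1}.  By induction on
-- the phases, M survives every phase and each M≤ i is a maximum matching of G′ i.
-- Survival uses the two facts on maximum matchings from EvenOdd.  Maximality:
-- a larger matching of G′ i augments M≤ i to a matching L; by the covering
-- lemma L matches at least as many applicants with ranks ≤ j + 1 as M for each
-- j < i, and strictly more with ranks ≤ i + 1, so L has a larger signature.
module Reduced (I : Instance) where

  open import Data.Nat using (ℕ; zero; suc; _≤_; _<_; z≤n; s≤s; _≤?_)
  open import Data.Nat.Properties
  open import Data.Bool using (true; false; _∧_)
  open import Data.Product using (_×_; _,_; proj₁; proj₂)
  open import Data.Sum using (_⊎_; inj₁; inj₂)
  open import Data.Empty using (⊥; ⊥-elim)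
  open import Relation.Binary.PropositionalEquality
  open import Relation.Nullary using (¬_; yes; no)
  open Matchings I
  open Rank I

  open Instance I

  G′ : ℕ → Graph I
  G′ i = Phase I (suc i) (Remaining I i)

  Remaining-mono : ∀ {j i} → j ≤ i → ∀ a p → Remaining I i a p → Remaining I j a p
  Remaining-mono {j} {zero}  z≤n a p e = e
  Remaining-mono {j} {suc i} j≤i a p e with m≤n⇒m<n∨m≡n j≤i
  ... | inj₁ (s≤s j≤i') = Remaining-mono j≤i' a p (proj₁ e)
  ... | inj₂ refl       = e

  Remaining⇒edge : ∀ i a p → Remaining I i a p → IsEdge I a p
  Remaining⇒edge i = Remaining-mono {0} {i} z≤n

  ⊆-from-pointwise : ∀ {X Y : Sel I} → (∀ a p → X a p ≡ true → Y a p ≡ true) → X ⊆ Y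
  ⊆-from-pointwise h (inj₁ a) (inj₂ p) e = h a p e
  ⊆-from-pointwise h (inj₂ p) (inj₁ a) e = h a p e

  restricted-matching : ∀ {G K} {X Y : Sel I} → IsSymMatching G Y → (∀ a p → X a p ≡ true → Y a p ≡ true) →
    (∀ a p → X a p ≡ true → K a p) → IsSymMatching K X
  restricted-matching {K = K} {X} (_ , functional) X⊆Y X∈K =
    edges , λ s t t' e e' → functional s t t' (⊆-from-pointwise X⊆Y s t e) (⊆-from-pointwise X⊆Y s t' e')
    where
    edges : ∀ s t → Joins X s t ≡ true → Adj I K s t
    edges (inj₁ a) (inj₂ p) e = X∈K a p e
    edges (inj₂ p) (inj₁ a) e = X∈K a p e

  sym⇒functional : ∀ {K} X → IsSymMatching K X → Functional X
  sym⇒functional X (_ , functional) a p p' e e' with functional (inj₁ a) (inj₂ p) (inj₂ p') e e'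
  ... | refl = refl

  survivor-high-rank : ∀ j a p → Remaining I (suc j) a p → RankGt I (suc j) a p →
    ¬ (OddOrUnreach I (G′ j) (inj₁ a) ⊎ OddOrUnreach I (G′ j) (inj₂ p))
  survivor-high-rank j a p (_ , notHigh , _) gt ou = notHigh (gt , ou)

  survivor-no-odd-edge : ∀ j a p → Remaining I (suc j) a p → G′ j a p →
    ¬ ((Odd I (G′ j) (inj₁ a) × OddOrUnreach I (G′ j) (inj₂ p)) ⊎ (Odd I (G′ j) (inj₂ p) × OddOrUnreach I (G′ j) (inj₁ a)))
  survivor-no-odd-edge j a p (_ , _ , notOdd) inG′ odd = notOdd (inG′ , odd)

  module RankMaximal (M : Sel I) (rankMax : IsRankMaximal I M) where

    isM : IsSymMatching (IsEdge I) M
    isM = toSym (proj₁ rankMax)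

    M≤ : ℕ → Sel I
    M≤ i = restrict M (suc i)

    M≤-mono : ∀ {j i} → j ≤ i → ∀ a p → M≤ j a p ≡ true → M≤ i a p ≡ true
    M≤-mono {j} {i} j≤i a p e with atMost⇒RankLe (suc j) a p (proj₂ (∧-true e))
    ... | k , ek , k≤j = trans (cong (_∧ atMost (suc i) (rank a p)) (proj₁ (∧-true e)))
                               (RankLe⇒atMost (suc i) a p (k , ek , ≤-trans k≤j (s≤s j≤i)))

    Survives : ℕ → Set
    Survives i = ∀ a p → M a p ≡ true → Remaining I i a p

    MaximumAt : ℕ → Set
    MaximumAt j = IsMaximumMatching I (G′ j) (M≤ j)

    M≤-matching : ∀ i → Survives i → IsSymMatching (G′ i) (M≤ i)
    M≤-matching i survives = restricted-matching isM (λ a p e → proj₁ (∧-true e))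
      (λ a p e → survives a p (proj₁ (∧-true e)) , atMost⇒RankLe (suc i) a p (proj₂ (∧-true e)))

    -- If M≤ i is maximum in G′ i, then no edge (a,p) of M is deleted in phase i + 1.
    -- If its rank exceeds i + 1, then a and p are free in M≤ i, hence not odd or
    -- unreachable; if it lies in G′ i with an odd endpoint, then the other endpoint
    -- is left free by some maximum matching, hence is not odd or unreachable.
    survives-step : ∀ i → Survives i → MaximumAt i → Survives (suc i)
    survives-step i survives maxᵢ a p e = survives a p e , notHigh , notOddEdge
      where
      open EvenOdd I (G′ i)
      a-free : RankGt I (suc i) a p → ¬ Matched (M≤ i) (inj₁ a)
      a-free gt (inj₂ q , e') with proj₁ (proj₂ (proj₁ rankMax)) a p q e (proj₁ (∧-true e'))
      ... | refl = RankGt⇒¬atMost (suc i) a p gt (proj₂ (∧-true e'))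
      p-free : RankGt I (suc i) a p → ¬ Matched (M≤ i) (inj₂ p)
      p-free gt (inj₁ b , e') with proj₂ (proj₂ (proj₁ rankMax)) a b p e (proj₁ (∧-true e'))
      ... | refl = RankGt⇒¬atMost (suc i) a p gt (proj₂ (∧-true e'))
      notHigh : ¬ (RankGt I (suc i) a p × (OddOrUnreach I (G′ i) (inj₁ a) ⊎ OddOrUnreach I (G′ i) (inj₂ p)))
      notHigh (gt , inj₁ ou) = free⇒¬oddOrUnreach (M≤ i) (inj₁ a) maxᵢ (a-free gt) ou
      notHigh (gt , inj₂ ou) = free⇒¬oddOrUnreach (M≤ i) (inj₂ p) maxᵢ (p-free gt) ou
      inM≤ : G′ i a p → M≤ i a p ≡ true
      inM≤ (_ , low) = trans (cong (_∧ atMost (suc i) (rank a p)) e) (RankLe⇒atMost (suc i) a p low)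
      notOddEdge : ¬ (G′ i a p × ((Odd I (G′ i) (inj₁ a) × OddOrUnreach I (G′ i) (inj₂ p)) ⊎
                                 (Odd I (G′ i) (inj₂ p) × OddOrUnreach I (G′ i) (inj₁ a))))
      notOddEdge (inG′ , inj₁ (a-odd , p-ou)) with odd⇒partnerFreeable (M≤ i) (inj₁ a) (inj₂ p) maxᵢ (inM≤ inG′) a-odd
      ... | N , maxN , p-freeN = free⇒¬oddOrUnreach N (inj₂ p) maxN p-freeN p-ou
      notOddEdge (inG′ , inj₂ (p-odd , a-ou)) with odd⇒partnerFreeable (M≤ i) (inj₂ p) (inj₁ a) maxᵢ (inM≤ inG′) p-odd
      ... | N , maxN , a-freeN = free⇒¬oddOrUnreach N (inj₁ a) maxN a-freeN a-ou

    -- A matching L of G′ i, one larger than M≤ i and matching every vertex matched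
    -- by M≤ i, would have a larger signature than M.
    module Competitor (i : ℕ) (i<r : suc i ≤ r) (survives : Survives i) (prev : ∀ j → j < i → MaximumAt j)
                      (L : Sel I) (isL : IsSymMatching (G′ i) L) (sizeL : size I L ≡ suc (size I (M≤ i)))
                      (coversL : ∀ w → Matched (M≤ i) w → Matched L w) where

      L∈G′ : ∀ a p → L a p ≡ true → G′ i a p
      L∈G′ a p e = proj₁ isL (inj₁ a) (inj₂ p) e

      L-remains : ∀ {j} → j ≤ i → ∀ a p → L a p ≡ true → Remaining I j a p
      L-remains j≤i a p e = Remaining-mono j≤i a p (proj₁ (L∈G′ a p e))

      isL-G : IsSymMatching (IsEdge I) L
      isL-G = restricted-matching isL (λ a p e → e) (λ a p e → Remaining⇒edge i a p (L-remains ≤-refl a p e))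

      -- All edges of L have rank ≤ i + 1, and L is larger than M≤ i.
      top : cumulative M (suc i) < cumulative L (suc i)
      top = subst (_≤ cumulative L (suc i)) sizeL (⊆-size low)
        where
        low : L ⊆ restrict L (suc i)
        low (inj₁ a) (inj₂ p) e = trans (cong (_∧ _) e) (RankLe⇒atMost (suc i) a p (proj₂ (L∈G′ a p e)))
        low (inj₂ p) (inj₁ a) e = trans (cong (_∧ _) e) (RankLe⇒atMost (suc i) a p (proj₂ (L∈G′ a p e)))

      module Below (j : ℕ) (j<i : j < i) where
        open EvenOdd I (G′ j) using (free⇒¬oddOrUnreach)
        open Cover I (G′ j) using (NoOddEdge; CoversOddUnreach; cover)

        L≤ : Sel I
        L≤ = restrict L (suc j)

        L≤-remains : ∀ a p → L≤ a p ≡ true → Remaining I (suc j) a p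
        L≤-remains a p e = L-remains j<i a p (proj₁ (∧-true e))

        isL≤ : IsSymMatching (G′ j) L≤
        isL≤ = restricted-matching isL (λ a p e → proj₁ (∧-true e))
          (λ a p e → L-remains (<⇒≤ j<i) a p (proj₁ (∧-true e)) , atMost⇒RankLe (suc j) a p (proj₂ (∧-true e)))

        noOdd : NoOddEdge L≤
        noOdd (inj₁ a) (inj₂ p) e odd ou =
          survivor-no-odd-edge j a p (L≤-remains a p e) (proj₁ isL≤ (inj₁ a) (inj₂ p) e) (inj₁ (odd , ou))
        noOdd (inj₂ p) (inj₁ a) e odd ou =
          survivor-no-odd-edge j a p (L≤-remains a p e) (proj₁ isL≤ (inj₂ p) (inj₁ a) e) (inj₂ (odd , ou))

        -- An edge of L at an odd or unreachable vertex of G′ j has rank ≤ j + 1, as it survived phase j + 1.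
        keep : ∀ w t → Joins L w t ≡ true → OddOrUnreach I (G′ j) w → Matched L≤ w
        keep (inj₁ a) (inj₂ p) e ou with atMost (suc j) (rank a p) in low
        ... | true  = inj₂ p , trans (cong (_∧ _) e) low
        ... | false = ⊥-elim (survivor-high-rank j a p (L-remains j<i a p e)
                                (¬atMost⇒RankGt (suc j) (suc i) a p (proj₂ (L∈G′ a p e)) low) (inj₁ ou))
        keep (inj₂ p) (inj₁ a) e ou with atMost (suc j) (rank a p) in low
        ... | true  = inj₁ a , trans (cong (_∧ _) e) low
        ... | false = ⊥-elim (survivor-high-rank j a p (L-remains j<i a p e)
                                (¬atMost⇒RankGt (suc j) (suc i) a p (proj₂ (L∈G′ a p e)) low) (inj₂ ou))

        -- An odd or unreachable vertex is matched by the maximum matching M≤ j, hence by M≤ i and by L.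
        covers : CoversOddUnreach L≤
        covers w ou with Matched? (M≤ j) w
        ... | no w-free = ⊥-elim (free⇒¬oddOrUnreach (M≤ j) w (prev j j<i) w-free ou)
        ... | yes (t , e) with coversL w (t , ⊆-from-pointwise (M≤-mono (<⇒≤ j<i)) w t e)
        ...   | t' , e' = keep w t' e' ou

        lower : cumulative M (suc j) ≤ cumulative L (suc j)
        lower = cover (M≤ j) L≤ (prev j j<i) isL≤ noOdd covers

      dominates : ∀ l → l ≤ suc i → cumulative M l ≤ cumulative L l
      dominates zero    _ = subst₂ _≤_ (sym (cumulative-zero M)) (sym (cumulative-zero L)) z≤n
      dominates (suc j) (s≤s j≤i) with m≤n⇒m<n∨m≡n j≤i
      ... | inj₁ j<i  = Below.lower j j<i
      ... | inj₂ refl = <⇒≤ top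

      beats : LexLe I (signature I L) (signature I M) → ⊥
      beats lex = dominating⇒¬LexLe r (countRank I M) (countRank I L) (suc i) i<r
        (λ l l≤ → subst₂ _≤_ (prefix M isM l l≤) (prefix L isL-G l l≤) (dominates l l≤))
        (subst₂ _<_ (prefix M isM (suc i) ≤-refl) (prefix L isL-G (suc i) ≤-refl) top)
        (subst₂ (LexLe I) (signature≡tabulate L) (signature≡tabulate M) lex)
        where
        prefix : ∀ X → IsSymMatching (IsEdge I) X → ∀ l → l ≤ suc i → cumulative X l ≡ prefixSum r (countRank I X) l
        prefix X isX l l≤ = cumulative≡prefixSum X (sym⇒functional X isX) l (≤-trans l≤ i<r)

    maximumAt : ∀ i → suc i ≤ r → Survives i → (∀ j → j < i → MaximumAt j) → MaximumAt i
    maximumAt i i<r survives prev = fromSym (M≤-matching i survives) , maximal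
      where
      maximal : ∀ N → IsMatching I (G′ i) N → size I N ≤ size I (M≤ i)
      maximal N isN with size I N ≤? size I (M≤ i)
      ... | yes N≤ = N≤
      ... | no N≰ with Augmentation.augment I (G′ i) (M≤ i) N (M≤-matching i survives) (toSym isN) (≰⇒> N≰)
      ...   | L , isL , sizeL , coversL = ⊥-elim (beats (proj₂ rankMax L (fromSym isL-G)))
        where open Competitor i i<r survives prev L isL sizeL coversL

    invariant : ∀ i → i ≤ r → Survives i × (∀ j → j < i → MaximumAt j)
    invariant zero    _   = (λ a p e → proj₁ (proj₁ rankMax) a p e) , λ j ()
    invariant (suc i) i<r with invariant i (<⇒≤ i<r)
    ... | survives , prev = survives-step i survives maxᵢ , prev'
      where
      maxᵢ : MaximumAt i
      maxᵢ = maximumAt i i<r survives prev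
      prev' : ∀ j → j < suc i → MaximumAt j
      prev' j j<1+i with m<1+n⇒m<n∨m≡n j<1+i
      ... | inj₁ j<i  = prev j j<i
      ... | inj₂ refl = maxᵢ

  rankMaximal⊆reduced : ∀ M → IsRankMaximal I M → ∀ a p → M a p ≡ true → Reduced I a p
  rankMaximal⊆reduced M rankMax = proj₁ (RankMaximal.invariant M rankMax r ≤-refl)

module Symmetry (I : Instance) where

  open import Data.Fin using (Fin; _≟_)
  open import Data.Fin.Permutation using (Permutation; _⟨$⟩ʳ_; _⟨$⟩ˡ_; inverseˡ; transpose)
  import Data.Fin.Permutation.Components as PC
  open import Data.Bool using (_∧_)
  open import Data.List using (allFin)
  open import Data.List.Properties using (map-cong)
  open import Data.Product using (_×_; _,_)
  open import Data.Sum using (_⊎_; inj₁; inj₂)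
  open import Data.Empty using (⊥-elim)
  open import Function using (_∘_)
  open import Relation.Binary.PropositionalEquality
  open import Relation.Nullary using (yes; no)
  open Counting
  open Rank I using (matchedWithRank; countRank≡count)

  open Instance I

  RankPreserving : Permutation nA nA → Set
  RankPreserving π = ∀ b q → rank (π ⟨$⟩ʳ b) q ≡ rank b q

  permuteApplicants : Permutation nA nA → Sel I → Sel I
  permuteApplicants π M b q = M (π ⟨$⟩ʳ b) q

  module _ (π : Permutation nA nA) (preserves : RankPreserving π) where

    permute-matching : ∀ {M} → IsMatching I (IsEdge I) M → IsMatching I (IsEdge I) (permuteApplicants π M)
    permute-matching (edges , funA , funP) =
      (λ b q e noEdge → edges (π ⟨$⟩ʳ b) q e (trans (preserves b q) noEdge)) ,
      (λ b q q' e e' → funA (π ⟨$⟩ʳ b) q q' e e') ,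
      (λ b b' q e e' → injective (funP (π ⟨$⟩ʳ b) (π ⟨$⟩ʳ b') q e e'))
      where
      injective : ∀ {b b'} → π ⟨$⟩ʳ b ≡ π ⟨$⟩ʳ b' → b ≡ b'
      injective {b} {b'} e = trans (sym (inverseˡ π)) (trans (cong (π ⟨$⟩ˡ_) e) (inverseˡ π))

    permute-signature : ∀ M → signature I (permuteApplicants π M) ≡ signature I M
    permute-signature M = map-cong same (allFin r)
      where
      same : ∀ j → countRank I (permuteApplicants π M) j ≡ countRank I M j
      same j = begin
        countRank I (permuteApplicants π M) j          ≡⟨ countRank≡count (permuteApplicants π M) j ⟩
        count (matchedWithRank (permuteApplicants π M) j) ≡⟨ count-cong renamed ⟩
        count (matchedWithRank M j ∘ (π ⟨$⟩ʳ_))        ≡⟨ count-permute (matchedWithRank M j) π ⟩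
        count (matchedWithRank M j)                     ≡⟨ countRank≡count M j ⟨
        countRank I M j                                 ∎
        where
        open ≡-Reasoning
        renamed : ∀ b → matchedWithRank (permuteApplicants π M) j b ≡ matchedWithRank M j (π ⟨$⟩ʳ b)
        renamed b = any-cong (allFin nP) λ q → cong (λ x → M (π ⟨$⟩ʳ b) q ∧ hasRank I x j) (sym (preserves b q))

    permute-rankMaximal : ∀ {M} → IsRankMaximal I M → IsRankMaximal I (permuteApplicants π M)
    permute-rankMaximal {M} (isM , maximal) =
      permute-matching isM , λ N isN → subst (LexLe I (signature I N)) (sym (permute-signature M)) (maximal N isN)

  transpose-cases : ∀ {n} (i j k : Fin n) →
    (k ≡ i × PC.transpose i j k ≡ j) ⊎ (k ≡ j × PC.transpose i j k ≡ i) ⊎ (k ≢ j × PC.transpose i j k ≡ k)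
  transpose-cases i j k with k ≟ i
  ... | yes k≡i = inj₁ (k≡i , refl)
  ... | no _ with k ≟ j
  ...   | yes k≡j = inj₂ (inj₁ (k≡j , refl))
  ...   | no k≢j  = inj₂ (inj₂ (k≢j , refl))

  module Swap (a a' : A I) (a≢a' : a ≢ a') (sameRanks : ∀ q → rank a q ≡ rank a' q) where

    swap : Permutation nA nA
    swap = transpose a a'

    swap-preserves : RankPreserving swap
    swap-preserves b q with transpose-cases a a' b
    ... | inj₁ (refl , e)        = trans (cong (λ x → rank x q) e) (sym (sameRanks q))
    ... | inj₂ (inj₁ (refl , e)) = trans (cong (λ x → rank x q) e) (sameRanks q)
    ... | inj₂ (inj₂ (_ , e))    = cong (λ x → rank x q) e

    swap-a' : swap ⟨$⟩ʳ a' ≡ a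
    swap-a' with transpose-cases a a' a'
    ... | inj₁ (a'≡a , _)      = ⊥-elim (a≢a' (sym a'≡a))
    ... | inj₂ (inj₁ (_ , e))  = e
    ... | inj₂ (inj₂ (a'≢a' , _)) = ⊥-elim (a'≢a' refl)

lemma12 : (I : Instance) → (a a' : A I) → (p : P I) →
          a ≢ a' →
          (∀ q → Instance.rank I a q ≡ Instance.rank I a' q) →
          Σ (Sel I) (λ M → IsRankMaximal I M × M a p ≡ true) →
          Reduced I a' p
lemma12 I a a' p a≢a' sameRanks (M , rankMax , ap) =
  Reduced.rankMaximal⊆reduced I M' (permute-rankMaximal swap swap-preserves rankMax) a' p a'p
  where
  open Symmetry I
  open Swap a a' a≢a' sameRanks
  M' : Sel I
  M' = permuteApplicants swap M
  a'p : M' a' p ≡ true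
  a'p = trans (cong (λ b → M b p) swap-a') ap
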